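{- Let $M=M[\mathcal{I}]$ be a multi-path matroid of rank $r$ and nullity $m$ on $[m+r]$, presented by an antichain $\mathcal{I}$ of $\sigma$-intervals with $\sigma=(1,2,\ldots,m+r)$, and let $D=D(\mathcal{I},1)$ have bottom border $P$ and top border $Q$. Let $B$ be a basis of $M$, $u\in B$, $v\notin B$, let $\Pi(B,p_i)$ be a valid path, and let $B'=(B-u)\cup v$. (1) If $v<u$, then $B'$ is a basis if and only if either (a) the path $(v,u)\Pi(B,p_i)$ does not touch $Q$, or (b) neither $[1,v)\Pi(B,p_i)$ nor $(u,m+r]\Pi(B,p_i)$ touches $P$. (2) If $u<v$, then $B'$ is a basis if and only if either (a) the path $(u,v)\Pi(B,p_i)$ does not touch $P$, or (b) neither $[1,u)\Pi(B,p_i)$ nor $(v,m+r]\Pi(B,p_i)$ touches $Q$.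
   Context: Transversal matroid: independent sets are the partial transversals of a multiset of subsets; a $\sigma$-interval is a nonempty set $\{f,\sigma(f),\ldots,l\}$ with first element $f$ and last element $l$; $\mathcal{I}$ is an antichain (no member contains another) of $r$ $\sigma$-intervals. Diagram $D=D(\mathcal{I},1)$: let $k-1$ be the number of intervals $I\in\mathcal{I}$ with $1\in I$ and $1$ not the first element of $I$. For $1\le i\le k$, $p_i=(k-i,i-1)$ and $p'_i=p_i+(m,r)$. $P$ is the lattice path from $p_1$ to $p'_1$ whose $t$-th step is North if $t$ is the last element of some interval of $\mathcal{I}$ and East otherwise; $Q$ is the lattice path from $p_k$ to $p'_k$ whose $t$-th step is North if $t$ is the first element of some interval and East otherwise. The region of $D$ is the closed region bounded by $P$, $Q$ and the lines of slope $-1$ through the $p_i$ and through the $p'_i$. For $X\subseteq[m+r]$ and a lattice point $p$, $\Pi(X,p)$ is the path of $m+r$ unit steps from $p$ whose $u$-th step is North if $u\in X$, East otherwise; it is valid if it lies entirely in the region of $D$ (the bases of $M$ are exactly the sets $B$ with $\Pi(B,p_i)$ valid and ending at $p'_i$ for some $i$). For $v\le u+1$, $[v,u]\Pi(X,p)$ is the portion from the beginning of step $v$ to the end of step $u$; in $(v,u]$, $[v,u)$, $(v,u)$ a round bracket means starting at the end of step $v$, resp. ending at the beginning of step $u$ (so $(u-1,u)\Pi$ is a single point). A path touches $P$ or $Q$ if it shares a point with it. -}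

module Defs where

-- Conventions:
--  * The ground set [m+r] = {1,...,n} (n = m + r) is represented by Fin n,
--    the paper's element t corresponding to the Fin element with toℕ = t - 1
--    (order-preserving).  So σ is x ↦ x+1 mod n and the paper's element 1 is
--    the element with toℕ = 0.
--  * A σ-interval is given by its first and last element (f , l);
--    its underlying set is {f, σ f, ..., l}.
--  * Subsets of the ground set are Data.Fin.Subset subsets.
--  * Lattice points are pairs of naturals (all relevant points lie in the
--    first quadrant).  The lattice point of a path after j steps (j = 0..n)
--    is indexed by j.

open import Data.Nat.Base using (ℕ; zero; suc; _+_; _∸_; _≤_; _≤ᵇ_; _<ᵇ_)
open import Data.Bool.Base using (Bool; true; false; if_then_else_; _∧_; _∨_; not; T)
open import Data.Fin.Base using (Fin; toℕ)
open import Data.Fin.Subset using (Subset; _∈_; _⊆_; ∣_∣)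
open import Data.Vec.Base using (lookup)
open import Data.List.Base using (List; map; allFin)
open import Data.Nat.ListAction using (sum)
open import Data.Bool.ListAction using (any)
open import Data.Product.Base using (Σ; _×_; _,_; proj₁; proj₂)
open import Relation.Binary.PropositionalEquality using (_≡_)
open import Relation.Nullary using (¬_)

Intervals : ℕ → ℕ → Set
Intervals n r = Fin r → Fin n × Fin n

first : ∀ {n r} → Intervals n r → Fin r → Fin n
first I a = proj₁ (I a)

last : ∀ {n r} → Intervals n r → Fin r → Fin n
last I a = proj₂ (I a)

inCyc : ℕ → ℕ → ℕ → Bool
inCyc f l x = if f ≤ᵇ l then ((f ≤ᵇ x) ∧ (x ≤ᵇ l)) else ((f ≤ᵇ x) ∨ (x ≤ᵇ l))

_∈I_ : ∀ {n r} → Fin n → (Σ (Intervals n r) λ _ → Fin r) → Set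
x ∈I (I , a) = T (inCyc (toℕ (first I a)) (toℕ (last I a)) (toℕ x))

Antichain : ∀ {n r} → Intervals n r → Set
Antichain {n} {r} I =
  ∀ (a b : Fin r) → ¬ (a ≡ b) → ¬ (∀ (x : Fin n) → x ∈I (I , a) → x ∈I (I , b))

-- Transversal matroid M[I]: X is independent iff it is a partial transversal,
-- i.e. there is an injective assignment of the elements of X to members of I
-- with every element lying in its assigned member.
Independent : ∀ {n r} → Intervals n r → Subset n → Set
Independent {n} {r} I X =
  Σ (Fin n → Fin r) λ φ →
    (∀ (x y : Fin n) → x ∈ X → y ∈ X → φ x ≡ φ y → x ≡ y) ×
    (∀ (x : Fin n) → x ∈ X → x ∈I (I , φ x))

Basis : ∀ {n r} → Intervals n r → Subset n → Set
Basis {n} I B = Independent I B × (∀ (Y : Subset n) → B ⊆ Y → Independent I Y → Y ⊆ B)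

HasRank : ∀ {n r} → Intervals n r → ℕ → Set
HasRank {n} I r = Σ (Subset n) λ X → Independent I X × ∣ X ∣ ≡ r

countBelow : ∀ {n} → (Fin n → Bool) → ℕ → ℕ
countBelow {n} f j = sum (map (λ x → if f x ∧ (toℕ x <ᵇ j) then 1 else 0) (allFin n))

Point : Set
Point = ℕ × ℕ

stepPath : ∀ {n} → (Fin n → Bool) → Point → ℕ → Point
stepPath north p j = (proj₁ p + countBelow (λ x → not (north x)) j , proj₂ p + countBelow north j)

Π : ∀ {n} → Subset n → Point → ℕ → Point
Π X p = stepPath (λ x → lookup X x) p

kOf : ∀ {n r} → Intervals n r → ℕ
kOf {n} {r} I = suc (sum (map (λ a →
  if inCyc (toℕ (first I a)) (toℕ (last I a)) 0 ∧ not (toℕ (first I a) ≤ᵇ 0)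
  then 1 else 0) (allFin r)))

pt : ∀ {n r} → Intervals n r → ℕ → Point
pt I i = (kOf I ∸ i , i ∸ 1)

isLast : ∀ {n r} → Intervals n r → Fin n → Bool
isLast {n} {r} I x = any (λ a → toℕ (last I a) ≡ᵇ toℕ x) (allFin r)
  where open import Data.Nat.Base using (_≡ᵇ_)

isFirst : ∀ {n r} → Intervals n r → Fin n → Bool
isFirst {n} {r} I x = any (λ a → toℕ (first I a) ≡ᵇ toℕ x) (allFin r)
  where open import Data.Nat.Base using (_≡ᵇ_)

Pb : ∀ {n r} → Intervals n r → ℕ → Point
Pb I = stepPath (isLast I) (pt I 1)

Qb : ∀ {n r} → Intervals n r → ℕ → Point
Qb I = stepPath (isFirst I) (pt I (kOf I))

-- A lattice point lies in the (closed) region of D(𝓘,1): it lies on one of the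
-- lines x + y = (k-1) + d, 0 ≤ d ≤ n (between the slope -1 lines through the
-- p_i and through the p'_i), weakly between Q and P on that line.
InRegion : ∀ {n r} → Intervals n r → Point → Set
InRegion {n} I (x , y) =
  Σ ℕ λ d → d ≤ n × (x + y ≡ (kOf I ∸ 1) + d) ×
    (proj₁ (Qb I d) ≤ x) × (x ≤ proj₁ (Pb I d))

Valid : ∀ {n r} → Intervals n r → Subset n → Point → Set
Valid {n} I X p = ∀ (j : ℕ) → j ≤ n → InRegion I (Π X p j)

TouchesOn : ∀ {n} → Subset n → Point → ℕ → ℕ → (ℕ → Point) → Set
TouchesOn {n} X p lo hi R =
  Σ ℕ λ j → lo ≤ j × j ≤ hi × Σ ℕ λ j' → j' ≤ n × Π X p j ≡ R j'

-- A set X of size r is a basis of M[I] exactly when, for some a ≤ K (K the number of intervals that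
-- wrap around), the path Π(X, p_{a+1}) stays between P and Q: after j steps its height a + |X ∩ [0, j)|
-- is at least the number of interval ends before j and at most K plus the number of interval starts
-- before j.  Given a matching, a is the number of elements matched into the final segment of a
-- wrapping interval; conversely, listing the intervals by their ends puts the wrapping ones first, and
-- matching the t-th element of X to the interval whose end has rank a + t mod r works.
-- Exchanging u ∈ B for v ∉ B changes the height by one exactly on the steps between u and v.  The new
-- path still fits with the same start unless it now crosses the border it moves towards on that
-- stretch; otherwise the start must move by one lattice point in the other direction, which is
-- possible precisely when the old path avoids the opposite border outside the stretch.

module Submission where

open import Defs
open import Data.Bool.Base using (Bool; true; false; if_then_else_; _∧_; _∨_; not; T)
open import Data.Bool.Properties using (T?; T-≡; T-∧; T-∨; ∧-zeroʳ; ∧-identityʳ)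
open import Data.Empty using (⊥; ⊥-elim)
open import Data.Fin.Base using (Fin; toℕ; fromℕ<) renaming (zero to fzero; suc to fsuc)
open import Data.Fin.Properties using (any?; toℕ-injective; toℕ<n; toℕ-fromℕ<)
  renaming (_≟_ to _≟ᶠ_; suc-injective to fsuc-injective)
open import Data.Fin.Subset using (Subset; _∈_; _∉_; _⊆_; _∪_; _─_; _-_; ⁅_⁆)
open import Data.Fin.Subset.Properties using (p⊆p∪q; q⊆p∪q; x∈⁅x⁆)
open import Data.List.Base using (tabulate; map; allFin)
open import Data.List.Properties using (map-tabulate)
open import Data.List.Relation.Unary.Any.Properties using (any⁺; any⁻; tabulate⁺; tabulate⁻)
open import Data.Bool.ListAction using (any)
open import Data.Nat.Base
open import Data.Nat.Properties
open import Algebra.Properties.CommutativeMonoid.Sum +-0-commutativeMonoid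
  using (sum; sum-cong-≗; ∑-distrib-+)
open import Algebra.Properties.CommutativeSemigroup +-commutativeSemigroup using (interchange)
import Data.Nat.ListAction as List
open import Data.Product.Base using (Σ; _×_; _,_; proj₁; proj₂)
open import Data.Sum.Base using (_⊎_; inj₁; inj₂; [_,_]′)
open import Data.Unit.Base using (tt)
open import Data.Vec.Base using (_∷_; lookup)
open import Data.Vec.Properties using (lookup-zipWith; lookup-replicate; []=⇒lookup; lookup⇒[]=)
open import Function.Base using (id; _∘_; case_of_)
open import Function.Bundles using (_⇔_; mk⇔; Equivalence)
open import Relation.Binary.Definitions using (tri<; tri≈; tri>)
open import Relation.Binary.PropositionalEquality
open import Relation.Nullary using (¬_; yes; no; does; ¬?)
open import Relation.Nullary.Decidable using (_×-dec_)

open Equivalence using (to; from)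

¬T⇒≡false : ∀ {b} → ¬ T b → b ≡ false
¬T⇒≡false {true} ¬b = ⊥-elim (¬b tt)
¬T⇒≡false {false} _ = refl

¬T⇒T-not : ∀ {b} → ¬ T b → T (not b)
¬T⇒T-not {true} ¬b = ¬b tt
¬T⇒T-not {false} _ = tt

T-not⇒¬T : ∀ {b} → T (not b) → ¬ T b
T-not⇒¬T {false} _ ()

<ᵇ-irrefl : ∀ m → ¬ T (m <ᵇ m)
<ᵇ-irrefl m t = <-irrefl refl (<ᵇ⇒< m m t)

indicator : Bool → ℕ
indicator b = if b then 1 else 0

indicator-true : ∀ {b} → T b → indicator b ≡ 1
indicator-true {true} _ = refl

indicator-false : ∀ {b} → ¬ T b → indicator b ≡ 0
indicator-false {b} ¬b = cong indicator (¬T⇒≡false ¬b)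

indicator-cong : ∀ {a b} → (T a → T b) → (T b → T a) → indicator a ≡ indicator b
indicator-cong {true} {true} _ _ = refl
indicator-cong {false} {false} _ _ = refl
indicator-cong {true} {false} a⇒b _ = ⊥-elim (a⇒b tt)
indicator-cong {false} {true} _ b⇒a = ⊥-elim (b⇒a tt)

indicator-mono : ∀ {a b} → (T a → T b) → indicator a ≤ indicator b
indicator-mono {false} _ = z≤n
indicator-mono {true} a⇒b rewrite to T-≡ (a⇒b tt) = ≤-refl

indicator-∨ : ∀ a b → (T a → ¬ T b) → indicator (a ∨ b) ≡ indicator a + indicator b
indicator-∨ true true disj = ⊥-elim (disj tt tt)
indicator-∨ true false _ = refl
indicator-∨ false b _ = refl

sum-mono-≤ : ∀ {n} {g h : Fin n → ℕ} → (∀ x → g x ≤ h x) → sum g ≤ sum h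
sum-mono-≤ {zero} _ = z≤n
sum-mono-≤ {suc n} g≤h = +-mono-≤ (g≤h fzero) (sum-mono-≤ (g≤h ∘ fsuc))

sum-zero : ∀ {n} (g : Fin n → ℕ) → (∀ x → g x ≡ 0) → sum g ≡ 0
sum-zero {zero} g _ = refl
sum-zero {suc n} g g≡0 = cong₂ _+_ (g≡0 fzero) (sum-zero (g ∘ fsuc) (g≡0 ∘ fsuc))

sum-point : ∀ {n} (g : Fin n → ℕ) (y : Fin n) → (∀ x → x ≢ y → g x ≡ 0) → sum g ≡ g y
sum-point {suc n} g fzero g≡0 =
  trans (cong (g fzero +_) (sum-zero (g ∘ fsuc) (λ x → g≡0 (fsuc x) λ ()))) (+-identityʳ _)
sum-point {suc n} g (fsuc y) g≡0 =
  cong₂ _+_ (g≡0 fzero λ ()) (sum-point (g ∘ fsuc) y (λ x x≢y → g≡0 (fsuc x) (x≢y ∘ fsuc-injective)))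

count : ∀ {n} → (Fin n → Bool) → ℕ
count f = sum (indicator ∘ f)

_≟ᵇ_ : ∀ {n} → Fin n → Fin n → Bool
x ≟ᵇ y = does (x ≟ᶠ y)

≟ᵇ⇒≡ : ∀ {n} {x y : Fin n} → T (x ≟ᵇ y) → x ≡ y
≟ᵇ⇒≡ {x = x} {y} t with x ≟ᶠ y
... | yes x≡y = x≡y

≟ᵇ-refl : ∀ {n} (x : Fin n) → T (x ≟ᵇ x)
≟ᵇ-refl x with x ≟ᶠ x
... | yes _ = tt
... | no x≢x = x≢x refl

≢⇒¬≟ᵇ : ∀ {n} {x y : Fin n} → x ≢ y → ¬ T (x ≟ᵇ y)
≢⇒¬≟ᵇ x≢y = x≢y ∘ ≟ᵇ⇒≡

without : ∀ {n} → (Fin n → Bool) → Fin n → Fin n → Bool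
without f y x = f x ∧ not (x ≟ᵇ y)

count-mono : ∀ {n} (f g : Fin n → Bool) → (∀ x → T (f x) → T (g x)) → count f ≤ count g
count-mono f g f⊆g = sum-mono-≤ (λ x → indicator-mono (f⊆g x))

count-const-true : ∀ {n} → count {n} (λ _ → true) ≡ n
count-const-true {zero} = refl
count-const-true {suc n} = cong suc (count-const-true {n})

count≤n : ∀ {n} (f : Fin n → Bool) → count f ≤ n
count≤n {n} f = ≤-trans (count-mono f (λ _ → true) (λ _ _ → tt)) (≤-reflexive (count-const-true {n}))

count-point : ∀ {n} (y : Fin n) → count (_≟ᵇ y) ≡ 1
count-point y = trans (sum-point _ y (λ x x≢y → indicator-false (≢⇒¬≟ᵇ x≢y))) (indicator-true (≟ᵇ-refl y))

count-∪ : ∀ {n} (h f g : Fin n → Bool) → (∀ x → T (h x) → T (f x) ⊎ T (g x)) → count h ≤ count f + count g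
count-∪ h f g split =
  ≤-trans (sum-mono-≤ (λ x → pointwise (f x) (g x) (h x) (split x)))
          (≤-reflexive (∑-distrib-+ (indicator ∘ f) (indicator ∘ g)))
  where
  pointwise : ∀ a b c → (T c → T a ⊎ T b) → indicator c ≤ indicator a + indicator b
  pointwise a b false _ = z≤n
  pointwise true b true _ = s≤s z≤n
  pointwise false true true _ = s≤s z≤n
  pointwise false false true c⇒a∨b with c⇒a∨b tt
  ... | inj₁ ()
  ... | inj₂ ()

count-disjoint : ∀ {n} (f g h : Fin n → Bool) → (∀ x → T (f x) → T (h x)) → (∀ x → T (g x) → T (h x)) →
  (∀ x → T (f x) → ¬ T (g x)) → count f + count g ≤ count h
count-disjoint f g h f⊆h g⊆h disj =
  ≤-trans (≤-reflexive (sym (∑-distrib-+ (indicator ∘ f) (indicator ∘ g))))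
          (sum-mono-≤ (λ x → pointwise (f x) (g x) (h x) (f⊆h x) (g⊆h x) (disj x)))
  where
  pointwise : ∀ a b c → (T a → T c) → (T b → T c) → (T a → ¬ T b) → indicator a + indicator b ≤ indicator c
  pointwise false false c _ _ _ = z≤n
  pointwise true false true _ _ _ = s≤s z≤n
  pointwise true false false a⇒c _ _ = ⊥-elim (a⇒c tt)
  pointwise false true true _ _ _ = s≤s z≤n
  pointwise false true false _ b⇒c _ = ⊥-elim (b⇒c tt)
  pointwise true true c _ _ d = ⊥-elim (d tt tt)

count-< : ∀ {n} (f g : Fin n → Bool) (y : Fin n) → (∀ x → T (f x) → T (g x)) →
  T (g y) → ¬ T (f y) → count f < count g
count-< f g y f⊆g gy ¬fy = begin-strict
  count f                   <⟨ m<m+n (count f) (s≤s z≤n) ⟩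
  count f + 1               ≡⟨ cong (count f +_) (sym (count-point y)) ⟩
  count f + count (_≟ᵇ y)   ≤⟨ count-disjoint f (_≟ᵇ y) g f⊆g (λ x x≡y → subst (T ∘ g) (sym (≟ᵇ⇒≡ x≡y)) gy)
                                (λ x fx x≡y → ¬fy (subst (T ∘ f) (≟ᵇ⇒≡ x≡y) fx)) ⟩
  count g                   ∎
  where open ≤-Reasoning

count-≤-injection : ∀ {n m} (f : Fin n → Bool) (g : Fin m → Bool) (φ : ∀ x → T (f x) → Fin m) →
  (∀ x fx → T (g (φ x fx))) → (∀ x y fx fy → φ x fx ≡ φ y fy → x ≡ y) → count f ≤ count g
count-≤-injection {zero} f g φ into inj = z≤n
count-≤-injection {suc n} f g φ into inj with f fzero in f0
... | false = count-≤-injection (f ∘ fsuc) g (φ ∘ fsuc) (into ∘ fsuc)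
                (λ x y fx fy e → fsuc-injective (inj (fsuc x) (fsuc y) fx fy e))
... | true = begin
  suc (count (f ∘ fsuc))          ≤⟨ s≤s (count-≤-injection (f ∘ fsuc) (without g y) (φ ∘ fsuc) into′
                                            (λ x y′ fx fy e → fsuc-injective (inj (fsuc x) (fsuc y′) fx fy e))) ⟩
  suc (count (without g y))       ≤⟨ count-< (without g y) g y (λ x gx → proj₁ (to T-∧ gx)) (into fzero f0′)
                                       (λ w → T-not⇒¬T (proj₂ (to T-∧ w)) (≟ᵇ-refl y)) ⟩
  count g                         ∎
  where
  open ≤-Reasoning
  f0′ : T (f fzero)
  f0′ = subst T (sym f0) tt
  y : Fin _
  y = φ fzero f0′
  into′ : ∀ x fx → T (without g y (φ (fsuc x) fx))
  into′ x fx = from T-∧ (into (fsuc x) fx , ¬T⇒T-not λ e → fz≢fs (inj fzero (fsuc x) f0′ fx (sym (≟ᵇ⇒≡ e))))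
    where
    fz≢fs : ∀ {k} {a : Fin k} → fzero ≢ fsuc a
    fz≢fs ()

count<n⇒nonmember : ∀ {n} (f : Fin n → Bool) → count f < n → Σ (Fin n) λ e → ¬ T (f e)
count<n⇒nonmember {n} f |f|<n with any? (λ x → ¬? (T? (f x)))
... | yes found = found
... | no none = ⊥-elim (<⇒≱ |f|<n (≤-trans (≤-reflexive (sym (count-const-true {n})))
                  (count-mono (λ _ → true) f (λ x _ → case T? (f x) of λ
                    { (yes fx) → fx ; (no ¬fx) → ⊥-elim (none (x , ¬fx)) }))))

count-≥-injection⇒onto : ∀ {n m} (f : Fin n → Bool) (g : Fin m → Bool) (φ : Fin n → Fin m) →
  (∀ x → T (f x) → T (g (φ x))) → (∀ x y → T (f x) → T (f y) → φ x ≡ φ y → x ≡ y) →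
  count g ≤ count f → ∀ y → T (g y) → Σ (Fin n) λ x → T (f x) × φ x ≡ y
count-≥-injection⇒onto f g φ into inj g≤f y gy with any? (λ x → T? (f x) ×-dec (φ x ≟ᶠ y))
... | yes hit = hit
... | no miss = ⊥-elim (<-irrefl refl (≤-trans f<g g≤f))
  where
  f<g : count f < count g
  f<g = ≤-<-trans
    (count-≤-injection f (without g y) (λ x _ → φ x)
      (λ x fx → from T-∧ (into x fx , ¬T⇒T-not (λ e → miss (x , fx , ≟ᵇ⇒≡ e))))
      (λ x y′ fx fy → inj x y′ fx fy))
    (count-< (without g y) g y (λ x w → proj₁ (to T-∧ w)) gy (λ w → T-not⇒¬T (proj₂ (to T-∧ w)) (≟ᵇ-refl y)))

sum-allFin : ∀ {n} (g : Fin n → ℕ) → List.sum (map g (allFin n)) ≡ sum g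
sum-allFin g = trans (cong List.sum (map-tabulate id g)) (sum-tabulate g)
  where
  sum-tabulate : ∀ {n} (g : Fin n → ℕ) → List.sum (tabulate g) ≡ sum g
  sum-tabulate {zero} g = refl
  sum-tabulate {suc n} g = cong (g fzero +_) (sum-tabulate (g ∘ fsuc))

countBelow≡count : ∀ {n} (f : Fin n → Bool) j → countBelow f j ≡ count (λ x → f x ∧ (toℕ x <ᵇ j))
countBelow≡count f j = sum-allFin (λ x → indicator (f x ∧ (toℕ x <ᵇ j)))

countBelow-zero : ∀ {n} (f : Fin n → Bool) → countBelow f 0 ≡ 0
countBelow-zero f = trans (countBelow≡count f 0) (sum-zero _ (λ x → cong indicator (∧-zeroʳ (f x))))

countBelow-beyond : ∀ {n} (f : Fin n → Bool) {j} → n ≤ j → countBelow f j ≡ count f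
countBelow-beyond f {j} n≤j = trans (countBelow≡count f j)
  (sum-cong-≗ (λ x → cong indicator
    (trans (cong (f x ∧_) (to T-≡ (<⇒<ᵇ (<-≤-trans (toℕ<n x) n≤j)))) (∧-identityʳ (f x)))))

countBelow-mono : ∀ {n} (f : Fin n → Bool) {j j′} → j ≤ j′ → countBelow f j ≤ countBelow f j′
countBelow-mono f {j} {j′} j≤j′ = subst₂ _≤_ (sym (countBelow≡count f j)) (sym (countBelow≡count f j′))
  (count-mono (λ x → f x ∧ (toℕ x <ᵇ j)) (λ x → f x ∧ (toℕ x <ᵇ j′)) (λ x t → let (fx , x<j) = to T-∧ t
                           in from T-∧ (fx , <⇒<ᵇ (≤-trans (<ᵇ⇒< (toℕ x) j x<j) j≤j′))))

indicator-∧-split : ∀ b {c d e} → (T c → T d ⊎ T e) → (T d → T c) → (T e → T c) → (T d → ¬ T e) →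
  indicator (b ∧ c) ≡ indicator (b ∧ d) + indicator (b ∧ e)
indicator-∧-split false _ _ _ _ = refl
indicator-∧-split true {c} {d} {e} c⇒d∨e d⇒c e⇒c disj with T? c | T? d | T? e
... | _ | yes td | yes te = ⊥-elim (disj td te)
... | no ¬c | yes td | no _ = ⊥-elim (¬c (d⇒c td))
... | no ¬c | no _ | yes te = ⊥-elim (¬c (e⇒c te))
... | yes tc | no ¬d | no ¬e = ⊥-elim ([ ¬d , ¬e ]′ (c⇒d∨e tc))
... | yes tc | yes td | no ¬e =
  trans (indicator-true tc) (sym (cong₂ _+_ (indicator-true td) (indicator-false ¬e)))
... | yes tc | no ¬d | yes te =
  trans (indicator-true tc) (sym (cong₂ _+_ (indicator-false ¬d) (indicator-true te)))
... | no ¬c | no ¬d | no ¬e =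
  trans (indicator-false ¬c) (sym (cong₂ _+_ (indicator-false ¬d) (indicator-false ¬e)))

countBelow-step : ∀ {n} (f : Fin n → Bool) (y : Fin n) →
  countBelow f (suc (toℕ y)) ≡ countBelow f (toℕ y) + indicator (f y)
countBelow-step f y = begin
  countBelow f (suc (toℕ y))
    ≡⟨ countBelow≡count f (suc (toℕ y)) ⟩
  count (λ x → f x ∧ (toℕ x <ᵇ suc (toℕ y)))
    ≡⟨ sum-cong-≗ (λ x → indicator-∧-split (f x) (split x) (before⇒ x) (at⇒ x) (disjoint x)) ⟩
  sum (λ x → indicator (f x ∧ (toℕ x <ᵇ toℕ y)) + indicator (f x ∧ (x ≟ᵇ y)))
    ≡⟨ ∑-distrib-+ (λ x → indicator (f x ∧ (toℕ x <ᵇ toℕ y))) (λ x → indicator (f x ∧ (x ≟ᵇ y))) ⟩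
  count (λ x → f x ∧ (toℕ x <ᵇ toℕ y)) + count (λ x → f x ∧ (x ≟ᵇ y))
    ≡⟨ cong₂ _+_ (sym (countBelow≡count f (toℕ y)))
         (sum-point _ y (λ x x≢y → cong indicator (trans (cong (f x ∧_) (¬T⇒≡false (≢⇒¬≟ᵇ x≢y))) (∧-zeroʳ (f x))))) ⟩
  countBelow f (toℕ y) + indicator (f y ∧ (y ≟ᵇ y))
    ≡⟨ cong (λ b → countBelow f (toℕ y) + indicator (f y ∧ b)) (to T-≡ (≟ᵇ-refl y)) ⟩
  countBelow f (toℕ y) + indicator (f y ∧ true)
    ≡⟨ cong (λ b → countBelow f (toℕ y) + indicator b) (∧-identityʳ (f y)) ⟩
  countBelow f (toℕ y) + indicator (f y) ∎
  where
  open ≡-Reasoning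
  split : ∀ x → T (toℕ x <ᵇ suc (toℕ y)) → T (toℕ x <ᵇ toℕ y) ⊎ T (x ≟ᵇ y)
  split x t with m≤n⇒m<n∨m≡n (s≤s⁻¹ (<ᵇ⇒< (toℕ x) (suc (toℕ y)) t))
  ... | inj₁ x<y = inj₁ (<⇒<ᵇ x<y)
  ... | inj₂ x≡y = inj₂ (subst (λ z → T (z ≟ᵇ y)) (sym (toℕ-injective x≡y)) (≟ᵇ-refl y))
  before⇒ : ∀ x → T (toℕ x <ᵇ toℕ y) → T (toℕ x <ᵇ suc (toℕ y))
  before⇒ x t = <⇒<ᵇ (m<n⇒m<1+n (<ᵇ⇒< (toℕ x) (toℕ y) t))
  at⇒ : ∀ x → T (x ≟ᵇ y) → T (toℕ x <ᵇ suc (toℕ y))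
  at⇒ x t = subst (λ z → T (toℕ z <ᵇ suc (toℕ y))) (sym (≟ᵇ⇒≡ {x = x} {y} t)) (<⇒<ᵇ (n<1+n (toℕ y)))
  disjoint : ∀ x → T (toℕ x <ᵇ toℕ y) → ¬ T (x ≟ᵇ y)
  disjoint x t e = <-irrefl (cong toℕ (≟ᵇ⇒≡ e)) (<ᵇ⇒< (toℕ x) (toℕ y) t)

countBelow-suc-≤ : ∀ {n} (f : Fin n → Bool) j → countBelow f (suc j) ≤ countBelow f j + 1
countBelow-suc-≤ {n} f j with j <? n
... | yes j<n = subst (λ i → countBelow f (suc i) ≤ countBelow f i + 1) (toℕ-fromℕ< j<n)
                  (≤-trans (≤-reflexive (countBelow-step f (fromℕ< j<n)))
                           (+-monoʳ-≤ _ (indicator-mono {f (fromℕ< j<n)} {true} (λ _ → tt))))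
... | no j≮n = ≤-trans (≤-reflexive (trans (countBelow-beyond f (m≤n⇒m≤1+n (≮⇒≥ j≮n)))
                                       (sym (countBelow-beyond f (≮⇒≥ j≮n)))))
                       (m≤m+n _ 1)

count-below : ∀ {n} j → j ≤ n → count {n} (λ x → toℕ x <ᵇ j) ≡ j
count-below {zero} zero _ = refl
count-below {suc n} zero _ = sum-zero {n} (λ x → indicator (toℕ (fsuc x) <ᵇ zero)) (λ _ → refl)
count-below {suc n} (suc j) (s≤s j≤n) = cong suc (count-below j j≤n)

countBelow-not+countBelow : ∀ {n} (f : Fin n → Bool) j → j ≤ n →
  countBelow (not ∘ f) j + countBelow f j ≡ j
countBelow-not+countBelow {n} f j j≤n = begin
  countBelow (not ∘ f) j + countBelow f j
    ≡⟨ cong₂ _+_ (countBelow≡count (not ∘ f) j) (countBelow≡count f j) ⟩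
  count (λ x → not (f x) ∧ (toℕ x <ᵇ j)) + count (λ x → f x ∧ (toℕ x <ᵇ j))
    ≡⟨ sym (∑-distrib-+ {n} (λ x → indicator (not (f x) ∧ (toℕ x <ᵇ j))) (λ x → indicator (f x ∧ (toℕ x <ᵇ j)))) ⟩
  sum (λ x → indicator (not (f x) ∧ (toℕ x <ᵇ j)) + indicator (f x ∧ (toℕ x <ᵇ j)))
    ≡⟨ sum-cong-≗ {n} (λ x → pointwise (f x) (toℕ x <ᵇ j)) ⟩
  count {n} (λ x → toℕ x <ᵇ j)
    ≡⟨ count-below j j≤n ⟩
  j ∎
  where
  open ≡-Reasoning
  pointwise : ∀ b c → indicator (not b ∧ c) + indicator (b ∧ c) ≡ indicator c
  pointwise true c = refl
  pointwise false c = +-identityʳ _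

countBelow-insert : ∀ {n} (g f : Fin n → Bool) (v : Fin n) →
  (∀ x → indicator (g x) ≡ indicator (f x) + indicator (x ≟ᵇ v)) →
  ∀ j → countBelow g j ≡ countBelow f j + indicator (toℕ v <ᵇ j)
countBelow-insert g f v g≡f+v j = begin
  countBelow g j
    ≡⟨ countBelow≡count g j ⟩
  count (λ x → g x ∧ (toℕ x <ᵇ j))
    ≡⟨ sum-cong-≗ (λ x → pointwise (g x) (f x) (x ≟ᵇ v) (toℕ x <ᵇ j) (g≡f+v x)) ⟩
  sum (λ x → indicator (f x ∧ (toℕ x <ᵇ j)) + indicator ((x ≟ᵇ v) ∧ (toℕ x <ᵇ j)))
    ≡⟨ ∑-distrib-+ (λ x → indicator (f x ∧ (toℕ x <ᵇ j))) (λ x → indicator ((x ≟ᵇ v) ∧ (toℕ x <ᵇ j))) ⟩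
  count (λ x → f x ∧ (toℕ x <ᵇ j)) + count (λ x → (x ≟ᵇ v) ∧ (toℕ x <ᵇ j))
    ≡⟨ cong₂ _+_ (sym (countBelow≡count f j))
         (sum-point _ v (λ x x≢v → cong (λ b → indicator (b ∧ (toℕ x <ᵇ j))) (¬T⇒≡false (≢⇒¬≟ᵇ x≢v)))) ⟩
  countBelow f j + indicator ((v ≟ᵇ v) ∧ (toℕ v <ᵇ j))
    ≡⟨ cong (λ b → countBelow f j + indicator (b ∧ (toℕ v <ᵇ j))) (to T-≡ (≟ᵇ-refl v)) ⟩
  countBelow f j + indicator (toℕ v <ᵇ j) ∎
  where
  open ≡-Reasoning
  pointwise : ∀ a b e c → indicator a ≡ indicator b + indicator e →
    indicator (a ∧ c) ≡ indicator (b ∧ c) + indicator (e ∧ c)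
  pointwise a b e true h rewrite ∧-identityʳ a | ∧-identityʳ b | ∧-identityʳ e = h
  pointwise a b e false h rewrite ∧-zeroʳ a | ∧-zeroʳ b | ∧-zeroʳ e = refl

T-lookup⇒∈ : ∀ {n} {x : Fin n} {X : Subset n} → T (lookup X x) → x ∈ X
T-lookup⇒∈ {x = x} {X} t = lookup⇒[]= x X (to T-≡ t)

∈⇒T-lookup : ∀ {n} {x : Fin n} {X : Subset n} → x ∈ X → T (lookup X x)
∈⇒T-lookup x∈X = subst T (sym ([]=⇒lookup x∈X)) tt

lookup-⁅⁆ : ∀ {n} (y x : Fin n) → lookup ⁅ y ⁆ x ≡ (x ≟ᵇ y)
lookup-⁅⁆ fzero fzero = refl
lookup-⁅⁆ {suc n} fzero (fsuc x) = lookup-replicate x false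
lookup-⁅⁆ (fsuc y) fzero = refl
lookup-⁅⁆ (fsuc y) (fsuc x) = lookup-⁅⁆ y x

lookup-∪ : ∀ {n} (p q : Subset n) x → lookup (p ∪ q) x ≡ (lookup p x ∨ lookup q x)
lookup-∪ p q x = lookup-zipWith _∨_ x p q

lookup-─ : ∀ {n} (p q : Subset n) x → lookup (p ─ q) x ≡ (lookup p x ∧ not (lookup q x))
lookup-─ (b ∷ p) (true ∷ q) fzero = sym (∧-zeroʳ b)
lookup-─ (b ∷ p) (false ∷ q) fzero = sym (∧-identityʳ b)
lookup-─ (b ∷ p) (c ∷ q) (fsuc x) = lookup-─ p q x

lookup-minus : ∀ {n} (p : Subset n) y x → lookup (p - y) x ≡ without (lookup p) y x
lookup-minus p y x = trans (lookup-─ p ⁅ y ⁆ x) (cong (λ b → lookup p x ∧ not b) (lookup-⁅⁆ y x))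

inCyc-cases : ∀ f l x → T (inCyc f l x) → (f ≤ l × f ≤ x × x ≤ l) ⊎ (l < f × (f ≤ x ⊎ x ≤ l))
inCyc-cases f l x t with f ≤ᵇ l in f≤ᵇl
... | true = let (f≤x , x≤l) = to T-∧ t
             in inj₁ (≤ᵇ⇒≤ f l (subst T (sym f≤ᵇl) tt) , ≤ᵇ⇒≤ f x f≤x , ≤ᵇ⇒≤ x l x≤l)
... | false = inj₂ ( ≰⇒> (λ f≤l → subst T f≤ᵇl (≤⇒≤ᵇ f≤l))
                   , [ inj₁ ∘ ≤ᵇ⇒≤ f x , inj₂ ∘ ≤ᵇ⇒≤ x l ]′ (to T-∨ t))

inCyc-linear : ∀ {f l x} → f ≤ l → f ≤ x → x ≤ l → T (inCyc f l x)
inCyc-linear f≤l f≤x x≤l rewrite to T-≡ (≤⇒≤ᵇ f≤l) = from T-∧ (≤⇒≤ᵇ f≤x , ≤⇒≤ᵇ x≤l)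

inCyc-wrapping : ∀ {f l x} → l < f → f ≤ x ⊎ x ≤ l → T (inCyc f l x)
inCyc-wrapping l<f f≤x⊎x≤l rewrite ¬T⇒≡false (<⇒≱ l<f ∘ ≤ᵇ⇒≤ _ _) =
  from T-∨ ([ inj₁ ∘ ≤⇒≤ᵇ , inj₂ ∘ ≤⇒≤ᵇ ]′ f≤x⊎x≤l)

inCyc-⊆-linear : ∀ {fa la fb lb} → fa ≤ la → fb ≤ lb → fb ≤ fa → la ≤ lb →
  ∀ x → T (inCyc fa la x) → T (inCyc fb lb x)
inCyc-⊆-linear fa≤la fb≤lb fb≤fa la≤lb x t with inCyc-cases _ _ x t
... | inj₁ (_ , fa≤x , x≤la) = inCyc-linear fb≤lb (≤-trans fb≤fa fa≤x) (≤-trans x≤la la≤lb)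
... | inj₂ (la<fa , _) = ⊥-elim (<⇒≱ la<fa fa≤la)

inCyc-⊆-wrapping : ∀ {fa la fb lb} → la < fa → lb < fb → fb ≤ fa → la ≤ lb →
  ∀ x → T (inCyc fa la x) → T (inCyc fb lb x)
inCyc-⊆-wrapping la<fa lb<fb fb≤fa la≤lb x t with inCyc-cases _ _ x t
... | inj₁ (fa≤la , _) = ⊥-elim (<⇒≱ la<fa fa≤la)
... | inj₂ (_ , inj₁ fa≤x) = inCyc-wrapping lb<fb (inj₁ (≤-trans fb≤fa fa≤x))
... | inj₂ (_ , inj₂ x≤la) = inCyc-wrapping lb<fb (inj₂ (≤-trans x≤la la≤lb))

inCyc-linear⊆wrapping : ∀ {fa la fb lb} → fa ≤ la → lb < fb → la ≤ lb ⊎ fb ≤ fa →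
  ∀ x → T (inCyc fa la x) → T (inCyc fb lb x)
inCyc-linear⊆wrapping fa≤la lb<fb la≤lb⊎fb≤fa x t with inCyc-cases _ _ x t
... | inj₂ (la<fa , _) = ⊥-elim (<⇒≱ la<fa fa≤la)
... | inj₁ (_ , fa≤x , x≤la) with la≤lb⊎fb≤fa
...   | inj₁ la≤lb = inCyc-wrapping lb<fb (inj₂ (≤-trans x≤la la≤lb))
...   | inj₂ fb≤fa = inCyc-wrapping lb<fb (inj₁ (≤-trans fb≤fa fa≤x))

isEndpoint : ∀ {n r} → (Fin r → Fin n) → Fin n → Bool
isEndpoint {r = r} e x = any (λ a → toℕ (e a) ≡ᵇ toℕ x) (allFin r)

isEndpoint⇒∃ : ∀ {n r} (e : Fin r → Fin n) {x} → T (isEndpoint e x) → Σ (Fin r) λ a → e a ≡ x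
isEndpoint⇒∃ {r = r} e {x} t =
  let (a , ea≡ᵇx) = tabulate⁻ (any⁻ (λ a → toℕ (e a) ≡ᵇ toℕ x) (allFin r) t)
  in a , toℕ-injective (≡ᵇ⇒≡ (toℕ (e a)) (toℕ x) ea≡ᵇx)

isEndpoint-endpoint : ∀ {n r} (e : Fin r → Fin n) a → T (isEndpoint e (e a))
isEndpoint-endpoint e a = any⁺ _ (tabulate⁺ a (≡⇒≡ᵇ (toℕ (e a)) (toℕ (e a)) refl))

countBelow-isEndpoint : ∀ {n r} (e : Fin r → Fin n) → (∀ a b → e a ≡ e b → a ≡ b) →
  ∀ j → countBelow (isEndpoint e) j ≡ count (λ a → toℕ (e a) <ᵇ j)
countBelow-isEndpoint e e-injective j = trans (countBelow≡count (isEndpoint e) j) (≤-antisym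
  (count-≤-injection _ _ (λ x t → proj₁ (isEndpoint⇒∃ e (proj₁ (to T-∧ t))))
    (λ x t → subst (λ y → T (toℕ y <ᵇ j)) (sym (proj₂ (isEndpoint⇒∃ e (proj₁ (to T-∧ t))))) (proj₂ (to T-∧ t)))
    (λ x y tx ty ax≡ay → trans (sym (proj₂ (isEndpoint⇒∃ e (proj₁ (to T-∧ tx)))))
                           (trans (cong e ax≡ay) (proj₂ (isEndpoint⇒∃ e (proj₁ (to T-∧ ty)))))))
  (count-≤-injection _ _ (λ a _ → e a) (λ a ea<j → from T-∧ (isEndpoint-endpoint e a , ea<j))
    (λ a b _ _ → e-injective a b)))

-- Antichains of σ-intervals

module AntichainOrder {n r : ℕ} (I : Intervals n r) (antichain : Antichain I) where

  start end : Fin r → ℕ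
  start a = toℕ (first I a)
  end a = toℕ (last I a)

  wraps : Fin r → Bool
  wraps a = end a <ᵇ start a

  wrapCount : ℕ
  wrapCount = count wraps

  -- An interval contains the element 1 without starting there exactly when it wraps around.
  kOf≡1+wrapCount : kOf I ≡ suc wrapCount
  kOf≡1+wrapCount = cong suc (trans (sum-allFin (λ a → indicator (inCyc (start a) (end a) 0 ∧ not (start a ≤ᵇ 0))))
                                     (sum-cong-≗ {r} (λ a → pointwise (start a) (end a))))
    where
    pointwise : ∀ f l → indicator (inCyc f l 0 ∧ not (f ≤ᵇ 0)) ≡ indicator (l <ᵇ f)
    pointwise zero l = cong indicator (∧-zeroʳ (inCyc zero l 0))
    pointwise (suc f) l with f <ᵇ l in f<ᵇl
    ... | true = indicator-cong {false} {l <ᵇ suc f} (λ ())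
      (λ l<1+f → <⇒≱ (<ᵇ⇒< f l (subst T (sym f<ᵇl) tt)) (s≤s⁻¹ (<ᵇ⇒< l (suc f) l<1+f)))
    ... | false = indicator-cong {true} {l <ᵇ suc f}
      (λ _ → <⇒<ᵇ {l} {suc f} (s≤s (≮⇒≥ (λ f<l → subst T f<ᵇl (<⇒<ᵇ f<l))))) (λ _ → tt)

  linear : ∀ {a} → ¬ T (wraps a) → start a ≤ end a
  linear ¬w = ≮⇒≥ (¬w ∘ <⇒<ᵇ)

  wrapping : ∀ {a} → T (wraps a) → end a < start a
  wrapping {a} w = <ᵇ⇒< (end a) (start a) w

  _⊆ᴵ_ : Fin r → Fin r → Set
  a ⊆ᴵ b = ∀ x → x ∈I (I , a) → x ∈I (I , b)

  SameKind : Fin r → Fin r → Set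
  SameKind a b = (T (wraps a) × T (wraps b)) ⊎ (¬ T (wraps a) × ¬ T (wraps b))

  SameKind-sym : ∀ {a b} → SameKind a b → SameKind b a
  SameKind-sym (inj₁ (wa , wb)) = inj₁ (wb , wa)
  SameKind-sym (inj₂ (la , lb)) = inj₂ (lb , la)

  nested⇒⊆ᴵ : ∀ a b → SameKind a b → start b ≤ start a → end a ≤ end b → a ⊆ᴵ b
  nested⇒⊆ᴵ a b (inj₁ (wa , wb)) sb≤sa ea≤eb x = inCyc-⊆-wrapping (wrapping wa) (wrapping wb) sb≤sa ea≤eb (toℕ x)
  nested⇒⊆ᴵ a b (inj₂ (la , lb)) sb≤sa ea≤eb x = inCyc-⊆-linear (linear la) (linear lb) sb≤sa ea≤eb (toℕ x)

  linear⊆ᴵwrapping : ∀ a b → ¬ T (wraps a) → T (wraps b) → end a ≤ end b ⊎ start b ≤ start a → a ⊆ᴵ b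
  linear⊆ᴵwrapping a b la wb cond x = inCyc-linear⊆wrapping (linear la) (wrapping wb) cond (toℕ x)

  kinds : ∀ a b → SameKind a b ⊎ (¬ T (wraps a) × T (wraps b)) ⊎ (T (wraps a) × ¬ T (wraps b))
  kinds a b with T? (wraps a) | T? (wraps b)
  ... | yes wa | yes wb = inj₁ (inj₁ (wa , wb))
  ... | no la | no lb = inj₁ (inj₂ (la , lb))
  ... | no la | yes wb = inj₂ (inj₁ (la , wb))
  ... | yes wa | no lb = inj₂ (inj₂ (wa , lb))

  ≢⇒¬⊆ᴵ : ∀ {a b} → a ≢ b → ¬ a ⊆ᴵ b
  ≢⇒¬⊆ᴵ {a} {b} = antichain a b

  start-<⇒end-< : ∀ a b → a ≢ b → SameKind a b → start a < start b → end a < end b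
  start-<⇒end-< a b a≢b same sa<sb =
    ≰⇒> (λ eb≤ea → ≢⇒¬⊆ᴵ (a≢b ∘ sym) (nested⇒⊆ᴵ b a (SameKind-sym same) (<⇒≤ sa<sb) eb≤ea))

  end-<⇒start-< : ∀ a b → a ≢ b → SameKind a b → end a < end b → start a < start b
  end-<⇒start-< a b a≢b same ea<eb = ≰⇒> (λ sb≤sa → ≢⇒¬⊆ᴵ a≢b (nested⇒⊆ᴵ a b same sb≤sa (<⇒≤ ea<eb)))

  linear-vs-wrapping : ∀ a b → ¬ T (wraps a) → T (wraps b) → end b < end a × start a < start b
  linear-vs-wrapping a b la wb =
      ≰⇒> (λ ea≤eb → ≢⇒¬⊆ᴵ a≢b (linear⊆ᴵwrapping a b la wb (inj₁ ea≤eb)))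
    , ≰⇒> (λ sb≤sa → ≢⇒¬⊆ᴵ a≢b (linear⊆ᴵwrapping a b la wb (inj₂ sb≤sa)))
    where
    a≢b : a ≢ b
    a≢b refl = la wb

  start-injective : ∀ a b → start a ≡ start b → a ≡ b
  start-injective a b sa≡sb with a ≟ᶠ b
  ... | yes a≡b = a≡b
  ... | no a≢b with kinds a b
  ...   | inj₁ same = [ (λ ea≤eb → ⊥-elim (≢⇒¬⊆ᴵ a≢b (nested⇒⊆ᴵ a b same (≤-reflexive (sym sa≡sb)) ea≤eb)))
                      , (λ eb≤ea → ⊥-elim (≢⇒¬⊆ᴵ (a≢b ∘ sym) (nested⇒⊆ᴵ b a (SameKind-sym same) (≤-reflexive sa≡sb) eb≤ea)))
                      ]′ (≤-total (end a) (end b))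
  ...   | inj₂ (inj₁ (la , wb)) = ⊥-elim (≢⇒¬⊆ᴵ a≢b (linear⊆ᴵwrapping a b la wb (inj₂ (≤-reflexive (sym sa≡sb)))))
  ...   | inj₂ (inj₂ (wa , lb)) = ⊥-elim (≢⇒¬⊆ᴵ (a≢b ∘ sym) (linear⊆ᴵwrapping b a lb wa (inj₂ (≤-reflexive sa≡sb))))

  end-injective : ∀ a b → end a ≡ end b → a ≡ b
  end-injective a b ea≡eb with a ≟ᶠ b
  ... | yes a≡b = a≡b
  ... | no a≢b with kinds a b
  ...   | inj₁ same = [ (λ sa≤sb → ⊥-elim (≢⇒¬⊆ᴵ (a≢b ∘ sym) (nested⇒⊆ᴵ b a (SameKind-sym same) sa≤sb (≤-reflexive (sym ea≡eb)))))
                      , (λ sb≤sa → ⊥-elim (≢⇒¬⊆ᴵ a≢b (nested⇒⊆ᴵ a b same sb≤sa (≤-reflexive ea≡eb))))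
                      ]′ (≤-total (start a) (start b))
  ...   | inj₂ (inj₁ (la , wb)) = ⊥-elim (≢⇒¬⊆ᴵ a≢b (linear⊆ᴵwrapping a b la wb (inj₁ (≤-reflexive ea≡eb))))
  ...   | inj₂ (inj₂ (wa , lb)) = ⊥-elim (≢⇒¬⊆ᴵ (a≢b ∘ sym) (linear⊆ᴵwrapping b a lb wa (inj₁ (≤-reflexive (sym ea≡eb)))))

  countBelow-isLast : ∀ j → countBelow (isLast I) j ≡ count (λ a → end a <ᵇ j)
  countBelow-isLast = countBelow-isEndpoint (last I) (λ a b → end-injective a b ∘ cong toℕ)

  countBelow-isFirst : ∀ j → countBelow (isFirst I) j ≡ count (λ a → start a <ᵇ j)
  countBelow-isFirst = countBelow-isEndpoint (first I) (λ a b → start-injective a b ∘ cong toℕ)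

  endRank startRank : Fin r → ℕ
  endRank a = count (λ b → end b <ᵇ end a)
  startRank a = count (λ b → start b <ᵇ start a)

  endRank-< : ∀ a b → end a < end b → endRank a < endRank b
  endRank-< a b ea<eb =
    count-< _ _ a (λ c ec<ea → <⇒<ᵇ (<-trans (<ᵇ⇒< _ _ ec<ea) ea<eb)) (<⇒<ᵇ ea<eb) (<ᵇ-irrefl (end a))

  endRank<r : ∀ a → endRank a < r
  endRank<r a = <-≤-trans (count-< _ (λ _ → true) a (λ _ _ → tt) tt (<ᵇ-irrefl (end a)))
                          (≤-reflexive (count-const-true {r}))

  endRank-injective : ∀ a b → endRank a ≡ endRank b → a ≡ b
  endRank-injective a b ra≡rb with <-cmp (end a) (end b)
  ... | tri< ea<eb _ _ = ⊥-elim (<-irrefl ra≡rb (endRank-< a b ea<eb))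
  ... | tri≈ _ ea≡eb _ = end-injective a b ea≡eb
  ... | tri> _ _ eb<ea = ⊥-elim (<-irrefl (sym ra≡rb) (endRank-< b a eb<ea))

  endRank-onto : ∀ ρ → ρ < r → Σ (Fin r) λ a → endRank a ≡ ρ
  endRank-onto ρ ρ<r =
    let (a , _ , ra≡ρ) = count-≥-injection⇒onto (λ _ → true) (λ _ → true) rank (λ _ _ → tt)
                           (λ a b _ _ → endRank-injective a b ∘ toℕ-rank) ≤-refl (fromℕ< ρ<r) tt
    in a , trans (sym (toℕ-fromℕ< (endRank<r a))) (trans (cong toℕ ra≡ρ) (toℕ-fromℕ< ρ<r))
    where
    rank : Fin r → Fin r
    rank a = fromℕ< (endRank<r a)
    toℕ-rank : ∀ {a b} → rank a ≡ rank b → endRank a ≡ endRank b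
    toℕ-rank {a} {b} e = trans (sym (toℕ-fromℕ< (endRank<r a))) (trans (cong toℕ e) (toℕ-fromℕ< (endRank<r b)))

  wrapCount≤r : wrapCount ≤ r
  wrapCount≤r = count≤n wraps

  -- Ordered by end, the wrapping intervals come first; ordered by start, they come last.
  linear⇒wrapCount≤endRank : ∀ J → ¬ T (wraps J) → wrapCount ≤ endRank J
  linear⇒wrapCount≤endRank J lJ = count-mono wraps (λ b → end b <ᵇ end J)
    (λ b wb → <⇒<ᵇ (proj₁ (linear-vs-wrapping J b lJ wb)))

  linear⇒startRank+wrapCount≡endRank : ∀ J → ¬ T (wraps J) → startRank J + wrapCount ≡ endRank J
  linear⇒startRank+wrapCount≡endRank J lJ =
    trans (sym (∑-distrib-+ (λ b → indicator (start b <ᵇ start J)) (indicator ∘ wraps))) (sum-cong-≗ pointwise)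
    where
    pointwise : ∀ b → indicator (start b <ᵇ start J) + indicator (wraps b) ≡ indicator (end b <ᵇ end J)
    pointwise b with T? (wraps b)
    ... | yes wb = trans (cong₂ _+_ (indicator-false (λ t → <-asym (<ᵇ⇒< _ _ t) (proj₂ (linear-vs-wrapping J b lJ wb))))
                                   (indicator-true wb))
                         (sym (indicator-true (<⇒<ᵇ (proj₁ (linear-vs-wrapping J b lJ wb)))))
    ... | no lb with b ≟ᶠ J
    ...   | yes refl = trans (cong (indicator (start b <ᵇ start b) +_) (indicator-false lb))
                             (trans (+-identityʳ _) (trans (indicator-false (<ᵇ-irrefl (start b)))
                                                           (sym (indicator-false (<ᵇ-irrefl (end b))))))
    ...   | no b≢J = trans (cong (indicator (start b <ᵇ start J) +_) (indicator-false lb)) (trans (+-identityʳ _)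
                       (indicator-cong (λ t → <⇒<ᵇ (start-<⇒end-< b J b≢J (inj₂ (lb , lJ)) (<ᵇ⇒< _ _ t)))
                                       (λ t → <⇒<ᵇ (end-<⇒start-< b J b≢J (inj₂ (lb , lJ)) (<ᵇ⇒< _ _ t)))))

  wrapping⇒startRank+wrapCount≡r+endRank : ∀ J → T (wraps J) → startRank J + wrapCount ≡ r + endRank J
  wrapping⇒startRank+wrapCount≡r+endRank J wJ =
    trans (sym (∑-distrib-+ (λ b → indicator (start b <ᵇ start J)) (indicator ∘ wraps)))
      (trans (sum-cong-≗ pointwise)
        (trans (∑-distrib-+ (λ _ → 1) (λ b → indicator (end b <ᵇ end J))) (cong (_+ endRank J) (count-const-true {r}))))
    where
    pointwise : ∀ b → indicator (start b <ᵇ start J) + indicator (wraps b) ≡ 1 + indicator (end b <ᵇ end J)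
    pointwise b with T? (wraps b)
    ... | no lb = trans (cong₂ _+_ (indicator-true (<⇒<ᵇ (proj₂ (linear-vs-wrapping b J lb wJ)))) (indicator-false lb))
                        (cong suc (sym (indicator-false (λ t → <-asym (<ᵇ⇒< _ _ t) (proj₁ (linear-vs-wrapping b J lb wJ))))))
    ... | yes wb with b ≟ᶠ J
    ...   | yes refl = trans (cong₂ _+_ (indicator-false (<ᵇ-irrefl (start b))) (indicator-true wb))
                             (cong suc (sym (indicator-false (<ᵇ-irrefl (end b)))))
    ...   | no b≢J = trans (cong (indicator (start b <ᵇ start J) +_) (indicator-true wb)) (trans (+-comm _ 1) (cong suc
                       (indicator-cong (λ t → <⇒<ᵇ (start-<⇒end-< b J b≢J (inj₁ (wb , wJ)) (<ᵇ⇒< _ _ t)))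
                                       (λ t → <⇒<ᵇ (end-<⇒start-< b J b≢J (inj₁ (wb , wJ)) (<ᵇ⇒< _ _ t))))))

-- reduce r q is q mod r as long as q < 2 r.
reduce : ℕ → ℕ → ℕ
reduce r q = if q <ᵇ r then q else q ∸ r

reduce-< : ∀ {r q} → q < r → reduce r q ≡ q
reduce-< q<r rewrite to T-≡ (<⇒<ᵇ q<r) = refl

reduce-≥ : ∀ {r q} → r ≤ q → reduce r q ≡ q ∸ r
reduce-≥ {r} {q} r≤q rewrite ¬T⇒≡false (λ t → <⇒≱ (<ᵇ⇒< q r t) r≤q) = refl

∸-<-window : ∀ {r a q} → r ≤ q → q < a + r → q ∸ r < a
∸-<-window {r} {a} r≤q q<a+r = +-cancelʳ-< r _ _ (subst (_< a + r) (sym (m∸n+n≡m r≤q)) q<a+r)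

reduce<r : ∀ {r a q} → a ≤ r → q < a + r → reduce r q < r
reduce<r {r} {a} {q} a≤r q<a+r with q <? r
... | yes q<r = subst (_< r) (sym (reduce-< q<r)) q<r
... | no q≮r = subst (_< r) (sym (reduce-≥ (≮⇒≥ q≮r))) (<-≤-trans (∸-<-window (≮⇒≥ q≮r) q<a+r) a≤r)

reduce-injective : ∀ {r a p q} → a ≤ p → p < a + r → a ≤ q → q < a + r → reduce r p ≡ reduce r q → p ≡ q
reduce-injective {r} {a} {p} {q} a≤p p<a+r a≤q q<a+r e with p <? r | q <? r
... | yes p<r | yes q<r = trans (sym (reduce-< p<r)) (trans e (reduce-< q<r))
... | no p≮r | no q≮r = trans (sym (m∸n+n≡m (≮⇒≥ p≮r)))
    (trans (cong (_+ r) (trans (sym (reduce-≥ (≮⇒≥ p≮r))) (trans e (reduce-≥ (≮⇒≥ q≮r))))) (m∸n+n≡m (≮⇒≥ q≮r)))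
... | yes p<r | no q≮r = ⊥-elim (<⇒≱ (∸-<-window (≮⇒≥ q≮r) q<a+r)
    (≤-trans a≤p (≤-reflexive (trans (sym (reduce-< p<r)) (trans e (reduce-≥ (≮⇒≥ q≮r)))))))
... | no p≮r | yes q<r = ⊥-elim (<⇒≱ (∸-<-window (≮⇒≥ p≮r) p<a+r)
    (≤-trans a≤q (≤-reflexive (trans (sym (reduce-< q<r)) (trans (sym e) (reduce-≥ (≮⇒≥ p≮r)))))))

downwards-from-last-nonmember : ∀ {n} (f : Fin n → Bool) (S : ℕ → Set) → S n →
  (∀ x → T (f x) → S (suc (toℕ x)) → S (toℕ x)) →
  (Σ (Fin n) λ e → ¬ T (f e) × (∀ j → toℕ e < j → j ≤ n → S j)) ⊎ (∀ j → j ≤ n → S j)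
downwards-from-last-nonmember {n} f S Sn step =
  [ inj₁ , (λ above → inj₂ λ j → above j z≤n) ]′ (go n 0 refl)
  where
  Found : Set
  Found = Σ (Fin n) λ e → ¬ T (f e) × (∀ j → toℕ e < j → j ≤ n → S j)
  Above : ℕ → Set
  Above i = ∀ j → i ≤ j → j ≤ n → S j
  extend : ∀ i (i<n : i < n) → Above (suc i) → Found ⊎ Above i
  extend i i<n above with T? (f (fromℕ< i<n))
  ... | no ¬fi = inj₁ (fromℕ< i<n , ¬fi , λ j i<j → above j (subst (_< j) (toℕ-fromℕ< i<n) i<j))
  ... | yes fi = inj₂ λ j i≤j j≤n → [ (λ i<j → above j i<j j≤n) , (λ { refl → Si }) ]′ (m≤n⇒m<n∨m≡n i≤j)
    where
    Si : S i
    Si = subst S (toℕ-fromℕ< i<n)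
           (step _ fi (subst (S ∘ suc) (sym (toℕ-fromℕ< i<n)) (above (suc i) ≤-refl i<n)))
  go : ∀ d i → i + d ≡ n → Found ⊎ Above i
  go zero i i+0≡n = inj₂ λ j i≤j j≤n →
    subst S (≤-antisym (subst (_≤ j) (trans (sym (+-identityʳ i)) i+0≡n) i≤j) j≤n) Sn
  go (suc d) i i+1+d≡n =
    [ inj₁ , extend i (subst (i <_) i+1+d≡n (m<m+n i z<s)) ]′ (go d (suc i) (trans (sym (+-suc i d)) i+1+d≡n))

-- Lattice paths

stepPath-diagonal : ∀ {n} (north : Fin n → Bool) (p : Point) j → j ≤ n →
  proj₁ (stepPath north p j) + proj₂ (stepPath north p j) ≡ (proj₁ p + proj₂ p) + j
stepPath-diagonal north (x , y) j j≤n =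
  trans (interchange x (countBelow (not ∘ north) j) y (countBelow north j))
        (cong ((x + y) +_) (countBelow-not+countBelow north j j≤n))

-- Two paths starting on the same diagonal meet exactly where, after equally many steps, they
-- are at the same height.
touchesOn⇒sameHeight : ∀ {n} (north : Fin n → Bool) (p₀ : Point) (X : Subset n) (p : Point) {lo hi} →
  proj₁ p + proj₂ p ≡ proj₁ p₀ + proj₂ p₀ → hi ≤ n → TouchesOn X p lo hi (stepPath north p₀) →
  Σ ℕ λ j → lo ≤ j × j ≤ hi × proj₂ p + countBelow (lookup X) j ≡ proj₂ p₀ + countBelow north j
touchesOn⇒sameHeight north p₀ X p diag hi≤n (j , lo≤j , j≤hi , j′ , j′≤n , meet) =
  j , lo≤j , j≤hi , trans (cong proj₂ meet) (cong (λ i → proj₂ p₀ + countBelow north i) (sym j≡j′))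
  where
  j≡j′ : j ≡ j′
  j≡j′ = +-cancelˡ-≡ (proj₁ p₀ + proj₂ p₀) _ _ (begin
    (proj₁ p₀ + proj₂ p₀) + j                                   ≡⟨ cong (_+ j) (sym diag) ⟩
    (proj₁ p + proj₂ p) + j                                     ≡⟨ sym (stepPath-diagonal (lookup X) p j (≤-trans j≤hi hi≤n)) ⟩
    proj₁ (Π X p j) + proj₂ (Π X p j)                           ≡⟨ cong (λ q → proj₁ q + proj₂ q) meet ⟩
    proj₁ (stepPath north p₀ j′) + proj₂ (stepPath north p₀ j′) ≡⟨ stepPath-diagonal north p₀ j′ j′≤n ⟩
    (proj₁ p₀ + proj₂ p₀) + j′                                  ∎)
    where open ≡-Reasoning

sameHeight⇒touchesOn : ∀ {n} (north : Fin n → Bool) (p₀ : Point) (X : Subset n) (p : Point) {lo hi} j →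
  proj₁ p + proj₂ p ≡ proj₁ p₀ + proj₂ p₀ → lo ≤ j → j ≤ hi → j ≤ n →
  proj₂ p + countBelow (lookup X) j ≡ proj₂ p₀ + countBelow north j → TouchesOn X p lo hi (stepPath north p₀)
sameHeight⇒touchesOn north p₀ X p j diag lo≤j j≤hi j≤n same = j , lo≤j , j≤hi , j , j≤n , cong₂ _,_ sameX same
  where
  sameX : proj₁ (Π X p j) ≡ proj₁ (stepPath north p₀ j)
  sameX = +-cancelʳ-≡ (proj₂ (Π X p j)) _ _ (begin
    proj₁ (Π X p j) + proj₂ (Π X p j)                         ≡⟨ stepPath-diagonal (lookup X) p j j≤n ⟩
    (proj₁ p + proj₂ p) + j                                   ≡⟨ cong (_+ j) diag ⟩
    (proj₁ p₀ + proj₂ p₀) + j                                 ≡⟨ sym (stepPath-diagonal north p₀ j j≤n) ⟩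
    proj₁ (stepPath north p₀ j) + proj₂ (stepPath north p₀ j) ≡⟨ cong (proj₁ (stepPath north p₀ j) +_) (sym same) ⟩
    proj₁ (stepPath north p₀ j) + proj₂ (Π X p j)             ∎)
    where open ≡-Reasoning

diagonal-antitone : ∀ {x y x′ y′} → x + y ≡ x′ + y′ → x′ ≤ x → y ≤ y′
diagonal-antitone {x} {y} {x′} {y′} diag x′≤x = +-cancelˡ-≤ x′ y y′ (≤-trans (+-monoˡ-≤ y x′≤x) (≤-reflexive diag))

regions : ∀ P Q j → j ≤ P ⊎ (P < j × j ≤ Q) ⊎ Q < j
regions P Q j with P <? j | Q <? j
... | no P≮j | _ = inj₁ (≮⇒≥ P≮j)
... | yes P<j | no Q≮j = inj₂ (inj₁ (P<j , ≮⇒≥ Q≮j))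
... | yes _ | yes Q<j = inj₂ (inj₂ Q<j)

-- Heights of two paths whose steps differ only at two positions P < Q.
module TwoStepDifference {P Q c c′ j : ℕ} (P<Q : P < Q)
  (differ : c′ + indicator (Q <ᵇ j) ≡ c + indicator (P <ᵇ j)) where

  ≡-before : j ≤ P → c′ ≡ c
  ≡-before j≤P = +-cancelʳ-≡ 0 c′ c (subst₂ (λ q p → c′ + q ≡ c + p)
    (indicator-false (≤⇒≯ (≤-trans j≤P (<⇒≤ P<Q)) ∘ <ᵇ⇒< Q j)) (indicator-false (≤⇒≯ j≤P ∘ <ᵇ⇒< P j)) differ)

  ≡suc-between : P < j → j ≤ Q → c′ ≡ suc c
  ≡suc-between P<j j≤Q = trans (sym (+-identityʳ c′)) (trans (subst₂ (λ q p → c′ + q ≡ c + p)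
    (indicator-false (≤⇒≯ j≤Q ∘ <ᵇ⇒< Q j)) (indicator-true (<⇒<ᵇ P<j)) differ) (+-comm c 1))

  ≡-after : Q < j → c′ ≡ c
  ≡-after Q<j = +-cancelʳ-≡ 1 c′ c (subst₂ (λ q p → c′ + q ≡ c + p)
    (indicator-true (<⇒<ᵇ Q<j)) (indicator-true (<⇒<ᵇ (<-trans P<Q Q<j))) differ)

  bounds : c ≤ c′ × c′ ≤ suc c
  bounds with regions P Q j
  ... | inj₁ j≤P = let e = ≡-before j≤P in ≤-reflexive (sym e) , ≤-trans (≤-reflexive e) (n≤1+n c)
  ... | inj₂ (inj₁ (P<j , j≤Q)) = let e = ≡suc-between P<j j≤Q in ≤-trans (n≤1+n c) (≤-reflexive (sym e)) , ≤-reflexive e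
  ... | inj₂ (inj₂ Q<j) = let e = ≡-after Q<j in ≤-reflexive (sym e) , ≤-trans (≤-reflexive e) (n≤1+n c)

-- Bases as lattice paths in the diagram

module LatticePaths {n r : ℕ} (I : Intervals n r) (antichain : Antichain I) where
  open AntichainOrder I antichain

  lastsBelow firstsBelow : ℕ → ℕ
  lastsBelow = countBelow (isLast I)
  firstsBelow = countBelow (isFirst I)

  below : Subset n → ℕ → ℕ
  below X = countBelow (lookup X)

  -- After j steps, Π(X, p_{a+1}) is at height a + below X j, and the borders P and Q are at
  -- heights lastsBelow j and wrapCount + firstsBelow j on the same diagonal.
  Fits : Subset n → ℕ → ℕ → Set
  Fits X a j = lastsBelow j ≤ a + below X j × a + below X j ≤ wrapCount + firstsBelow j

  independent⇒count≤r : ∀ X → Independent I X → count (lookup X) ≤ r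
  independent⇒count≤r X (φ , φ-injective , _) =
    ≤-trans (count-≤-injection (lookup X) (λ _ → true) (λ x _ → φ x) (λ _ _ → tt)
               (λ x y tx ty → φ-injective x y (T-lookup⇒∈ tx) (T-lookup⇒∈ ty)))
            (≤-reflexive (count-const-true {r}))

  independent∧count≡r⇒basis : ∀ X → Independent I X → count (lookup X) ≡ r → Basis I X
  independent∧count≡r⇒basis X indep |X|≡r = indep , maximal
    where
    maximal : ∀ Y → X ⊆ Y → Independent I Y → Y ⊆ X
    maximal Y X⊆Y indepY {y} y∈Y with T? (lookup X y)
    ... | yes y∈X = T-lookup⇒∈ y∈X
    ... | no y∉X = ⊥-elim (<⇒≱ (subst (_< count (lookup Y)) |X|≡r
                     (count-< (lookup X) (lookup Y) y (λ x t → ∈⇒T-lookup (X⊆Y (T-lookup⇒∈ t))) (∈⇒T-lookup y∈Y) y∉X))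
                     (independent⇒count≤r Y indepY))

  module ShiftOfMatching (X : Subset n) (φ : Fin n → Fin r)
    (φ-injective : ∀ x y → x ∈ X → y ∈ X → φ x ≡ φ y → x ≡ y)
    (φ-member : ∀ x → x ∈ X → x ∈I (I , φ x)) where

    inX : Fin n → Bool
    inX = lookup X

    injective : ∀ x y → T (inX x) → T (inX y) → φ x ≡ φ y → x ≡ y
    injective x y tx ty = φ-injective x y (T-lookup⇒∈ tx) (T-lookup⇒∈ ty)

    member : ∀ x → T (inX x) → T (inCyc (start (φ x)) (end (φ x)) (toℕ x))
    member x tx = φ-member x (T-lookup⇒∈ tx)

    matchedToWrapping inWrapTail inWrapHead : Fin n → Bool
    matchedToWrapping x = inX x ∧ wraps (φ x)
    inWrapTail x = matchedToWrapping x ∧ not (toℕ x ≤ᵇ end (φ x))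
    inWrapHead x = matchedToWrapping x ∧ (toℕ x ≤ᵇ end (φ x))

    shift : ℕ
    shift = count inWrapTail

    shift+head≤wrapCount : shift + count inWrapHead ≤ wrapCount
    shift+head≤wrapCount = ≤-trans
      (count-disjoint inWrapTail inWrapHead matchedToWrapping
        (λ x → proj₁ ∘ to (T-∧ {matchedToWrapping x})) (λ x → proj₁ ∘ to (T-∧ {matchedToWrapping x}))
        (λ x tail head → T-not⇒¬T (proj₂ (to (T-∧ {matchedToWrapping x}) tail))
                                  (proj₂ (to (T-∧ {matchedToWrapping x}) head))))
      (count-≤-injection matchedToWrapping wraps (λ x _ → φ x) (λ x → proj₂ ∘ to (T-∧ {inX x}))
        (λ x y tx ty → injective x y (proj₁ (to (T-∧ {inX x}) tx)) (proj₁ (to (T-∧ {inX y}) ty))))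

    shift≤wrapCount : shift ≤ wrapCount
    shift≤wrapCount = ≤-trans (m≤m+n shift _) shift+head≤wrapCount

    -- An element of X below j lies in the initial segment of a wrapping interval or in an
    -- interval starting below j.
    fits-upper : ∀ j → shift + below X j ≤ wrapCount + firstsBelow j
    fits-upper j = begin
      shift + below X j
        ≡⟨ cong (shift +_) (countBelow≡count inX j) ⟩
      shift + count (λ x → inX x ∧ (toℕ x <ᵇ j))
        ≤⟨ +-monoʳ-≤ shift (count-∪ _ inWrapHead startsBelow split) ⟩
      shift + (count inWrapHead + count startsBelow)
        ≡⟨ sym (+-assoc shift _ _) ⟩
      shift + count inWrapHead + count startsBelow
        ≤⟨ +-mono-≤ shift+head≤wrapCount
             (count-≤-injection startsBelow (λ b → start b <ᵇ j) (λ x _ → φ x) (λ x → proj₂ ∘ to T-∧)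
               (λ x y tx ty → injective x y (proj₁ (to T-∧ tx)) (proj₁ (to T-∧ ty)))) ⟩
      wrapCount + count (λ b → start b <ᵇ j)
        ≡⟨ cong (wrapCount +_) (sym (countBelow-isFirst j)) ⟩
      wrapCount + firstsBelow j ∎
      where
      open ≤-Reasoning hiding (start)
      startsBelow : Fin n → Bool
      startsBelow x = inX x ∧ (start (φ x) <ᵇ j)
      split : ∀ x → T (inX x ∧ (toℕ x <ᵇ j)) → T (inWrapHead x) ⊎ T (startsBelow x)
      split x t with to (T-∧ {inX x}) t
      ... | (tx , x<j) with inCyc-cases (start (φ x)) (end (φ x)) (toℕ x) (member x tx)
      ...   | inj₁ (_ , s≤x , _) = inj₂ (from T-∧ (tx , <⇒<ᵇ (≤-<-trans s≤x (<ᵇ⇒< (toℕ x) j x<j))))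
      ...   | inj₂ (_ , inj₁ s≤x) = inj₂ (from T-∧ (tx , <⇒<ᵇ (≤-<-trans s≤x (<ᵇ⇒< (toℕ x) j x<j))))
      ...   | inj₂ (e<s , inj₂ x≤e) = inj₁ (from T-∧ (from T-∧ (tx , <⇒<ᵇ e<s) , ≤⇒≤ᵇ x≤e))

    -- Every interval ending below j is matched to an element of X below j or in a final segment.
    fits-lower : count inX ≡ r → ∀ j → lastsBelow j ≤ shift + below X j
    fits-lower |X|≡r j = begin
      lastsBelow j
        ≡⟨ countBelow-isLast j ⟩
      count (λ b → end b <ᵇ j)
        ≤⟨ count-≤-injection (λ b → end b <ᵇ j) (λ x → (inX x ∧ (toℕ x <ᵇ j)) ∨ inWrapTail x)
             (λ b _ → proj₁ (matchOf b)) into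
             (λ b c _ _ e → trans (sym (proj₂ (proj₂ (matchOf b)))) (trans (cong φ e) (proj₂ (proj₂ (matchOf c))))) ⟩
      count (λ x → (inX x ∧ (toℕ x <ᵇ j)) ∨ inWrapTail x)
        ≤⟨ count-∪ _ (λ x → inX x ∧ (toℕ x <ᵇ j)) inWrapTail (λ x → to T-∨) ⟩
      count (λ x → inX x ∧ (toℕ x <ᵇ j)) + shift
        ≡⟨ cong (_+ shift) (sym (countBelow≡count inX j)) ⟩
      below X j + shift
        ≡⟨ +-comm (below X j) shift ⟩
      shift + below X j ∎
      where
      open ≤-Reasoning hiding (start)
      matchOf : ∀ b → Σ (Fin n) λ x → T (inX x) × φ x ≡ b
      matchOf b = count-≥-injection⇒onto inX (λ _ → true) φ (λ _ _ → tt) injective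
                    (≤-reflexive (trans (count-const-true {r}) (sym |X|≡r))) b tt
      into : ∀ b → T (end b <ᵇ j) →
        T ((inX (proj₁ (matchOf b)) ∧ (toℕ (proj₁ (matchOf b)) <ᵇ j)) ∨ inWrapTail (proj₁ (matchOf b)))
      into b e<j with matchOf b
      ... | (x , tx , refl) with toℕ x <? j
      ...   | yes x<j = from T-∨ (inj₁ (from T-∧ (tx , <⇒<ᵇ x<j)))
      ...   | no x≮j with inCyc-cases (start (φ x)) (end (φ x)) (toℕ x) (member x tx)
      ...     | inj₁ (_ , _ , x≤e) = ⊥-elim (x≮j (≤-<-trans x≤e (<ᵇ⇒< _ _ e<j)))
      ...     | inj₂ (_ , inj₂ x≤e) = ⊥-elim (x≮j (≤-<-trans x≤e (<ᵇ⇒< _ _ e<j)))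
      ...     | inj₂ (e<s , inj₁ _) = from T-∨ (inj₂ (from T-∧ (from T-∧ (tx , <⇒<ᵇ e<s) ,
                    ¬T⇒T-not (λ x≤e → x≮j (≤-<-trans (≤ᵇ⇒≤ _ _ x≤e) (<ᵇ⇒< _ _ e<j))))))

  independent⇒fits : ∀ X → Independent I X → count (lookup X) ≡ r →
    Σ ℕ λ a → a ≤ wrapCount × (∀ j → Fits X a j)
  independent⇒fits X (φ , φ-injective , φ-member) |X|≡r =
    shift , shift≤wrapCount , λ j → fits-lower |X|≡r j , fits-upper j
    where open ShiftOfMatching X φ φ-injective φ-member

  -- The element of X at position t (counted from 0) is matched to the interval whose end has
  -- rank a + t modulo r; the fit conditions at its position say that it lies in that interval.
  module MatchingFromShift (X : Subset n) (a : ℕ) (a≤wrapCount : a ≤ wrapCount) (|X|≤r : count (lookup X) ≤ r)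
    (fallback : Fin r) (fits : ∀ j → j ≤ n → Fits X a j) where

    inX : Fin n → Bool
    inX = lookup X

    intervalOfEndRank : ℕ → Fin r
    intervalOfEndRank ρ with any? (λ J → endRank J ≟ ρ)
    ... | yes (J , _) = J
    ... | no _ = fallback

    endRank-intervalOfEndRank : ∀ ρ → ρ < r → endRank (intervalOfEndRank ρ) ≡ ρ
    endRank-intervalOfEndRank ρ ρ<r with any? (λ J → endRank J ≟ ρ)
    ... | yes (_ , rank≡ρ) = rank≡ρ
    ... | no none = ⊥-elim (none (endRank-onto ρ ρ<r))

    position height : Fin n → ℕ
    position x = below X (toℕ x)
    height x = a + position x

    assigned : Fin n → Fin r
    assigned x = intervalOfEndRank (reduce r (height x))

    below-after : ∀ x → T (inX x) → below X (suc (toℕ x)) ≡ suc (position x)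
    below-after x tx = trans (countBelow-step inX x) (trans (cong (position x +_) (indicator-true tx)) (+-comm _ 1))

    position<r : ∀ x → T (inX x) → position x < r
    position<r x tx = begin-strict
      position x              <⟨ n<1+n _ ⟩
      suc (position x)        ≡⟨ sym (below-after x tx) ⟩
      below X (suc (toℕ x))   ≤⟨ countBelow-mono inX (toℕ<n x) ⟩
      below X n               ≡⟨ countBelow-beyond inX ≤-refl ⟩
      count inX               ≤⟨ |X|≤r ⟩
      r                       ∎
      where open ≤-Reasoning hiding (start)

    height<a+r : ∀ x → T (inX x) → height x < a + r
    height<a+r x tx = +-monoʳ-< a (position<r x tx)

    endRank-assigned : ∀ x → T (inX x) → endRank (assigned x) ≡ reduce r (height x)
    endRank-assigned x tx =
      endRank-intervalOfEndRank _ (reduce<r (≤-trans a≤wrapCount wrapCount≤r) (height<a+r x tx))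

    ≤end : ∀ x J → endRank J ≡ height x → toℕ x ≤ end J
    ≤end x J rank≡height = ≮⇒≥ λ e<x → <-irrefl refl (begin-strict
      endRank J                   <⟨ count-< (λ b → end b <ᵇ end J) (λ b → end b <ᵇ toℕ x) J
                                       (λ b t → <⇒<ᵇ (<-trans (<ᵇ⇒< _ _ t) e<x)) (<⇒<ᵇ e<x) (<ᵇ-irrefl (end J)) ⟩
      count (λ b → end b <ᵇ toℕ x) ≡⟨ sym (countBelow-isLast (toℕ x)) ⟩
      lastsBelow (toℕ x)          ≤⟨ proj₁ (fits (toℕ x) (<⇒≤ (toℕ<n x))) ⟩
      height x                    ≡⟨ sym rank≡height ⟩
      endRank J                   ∎)
      where open ≤-Reasoning hiding (start)

    start≤ : ∀ x J → T (inX x) → startRank J + wrapCount ≡ height x → start J ≤ toℕ x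
    start≤ x J tx rank≡height = ≮⇒≥ λ x<s → <-irrefl refl (begin-strict
      height x                                 <⟨ subst (_≤ wrapCount + firstsBelow (suc (toℕ x)))
                                                     (trans (cong (a +_) (below-after x tx)) (+-suc a _))
                                                     (proj₂ (fits (suc (toℕ x)) (toℕ<n x))) ⟩
      wrapCount + firstsBelow (suc (toℕ x))    ≡⟨ cong (wrapCount +_) (countBelow-isFirst (suc (toℕ x))) ⟩
      wrapCount + count (λ b → start b <ᵇ suc (toℕ x))
                                               ≤⟨ +-monoʳ-≤ wrapCount (count-mono _ (λ b → start b <ᵇ start J)
                                                     (λ b t → <⇒<ᵇ (≤-<-trans (s≤s⁻¹ (<ᵇ⇒< (start b) (suc (toℕ x)) t)) x<s))) ⟩
      wrapCount + startRank J                  ≡⟨ +-comm wrapCount _ ⟩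
      startRank J + wrapCount                  ≡⟨ rank≡height ⟩
      height x                                 ∎)
      where open ≤-Reasoning hiding (start)

    assigned-member : ∀ x → T (inX x) → x ∈I (I , assigned x)
    assigned-member x tx = member (assigned x) (endRank-assigned x tx)
      where
      member : ∀ b → endRank b ≡ reduce r (height x) → T (inCyc (start b) (end b) (toℕ x))
      member b rank≡ with height x <? r | T? (wraps b)
      ... | yes h<r | yes wb = inCyc-wrapping (wrapping wb) (inj₂ (≤end x b (trans rank≡ (reduce-< h<r))))
      ... | yes h<r | no lb = inCyc-linear (linear lb)
        (start≤ x b tx (trans (linear⇒startRank+wrapCount≡endRank b lb) (trans rank≡ (reduce-< h<r))))
        (≤end x b (trans rank≡ (reduce-< h<r)))
      ... | no h≮r | yes wb = inCyc-wrapping (wrapping wb) (inj₁ (start≤ x b tx (begin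
        startRank b + wrapCount       ≡⟨ wrapping⇒startRank+wrapCount≡r+endRank b wb ⟩
        r + endRank b                 ≡⟨ cong (r +_) (trans rank≡ (reduce-≥ (≮⇒≥ h≮r))) ⟩
        r + (height x ∸ r)            ≡⟨ m+[n∸m]≡n (≮⇒≥ h≮r) ⟩
        height x                      ∎)))
        where open ≡-Reasoning
      ... | no h≮r | no lb = ⊥-elim (<⇒≱ (∸-<-window (≮⇒≥ h≮r) (height<a+r x tx))
        (≤-trans a≤wrapCount (≤-trans (linear⇒wrapCount≤endRank b lb) (≤-reflexive (trans rank≡ (reduce-≥ (≮⇒≥ h≮r)))))))

    position-injective : ∀ x y → T (inX x) → T (inX y) → position x ≡ position y → x ≡ y
    position-injective x y tx ty p≡p with <-cmp (toℕ x) (toℕ y)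
    ... | tri≈ _ x≡y _ = toℕ-injective x≡y
    ... | tri< x<y _ _ =
      ⊥-elim (<-irrefl p≡p (≤-trans (≤-reflexive (sym (below-after x tx))) (countBelow-mono inX x<y)))
    ... | tri> _ _ y<x =
      ⊥-elim (<-irrefl (sym p≡p) (≤-trans (≤-reflexive (sym (below-after y ty))) (countBelow-mono inX y<x)))

    assigned-injective : ∀ x y → T (inX x) → T (inX y) → assigned x ≡ assigned y → x ≡ y
    assigned-injective x y tx ty same = position-injective x y tx ty (+-cancelˡ-≡ a _ _
      (reduce-injective (m≤m+n a _) (height<a+r x tx) (m≤m+n a _) (height<a+r y ty)
        (trans (sym (endRank-assigned x tx)) (trans (cong endRank same) (endRank-assigned y ty)))))

  fits⇒independent : ∀ X a → a ≤ wrapCount → count (lookup X) ≤ r → Fin r →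
    (∀ j → j ≤ n → Fits X a j) → Independent I X
  fits⇒independent X a a≤wrapCount |X|≤r fallback fits =
      assigned
    , (λ x y x∈X y∈X → assigned-injective x y (∈⇒T-lookup x∈X) (∈⇒T-lookup y∈X))
    , (λ x x∈X → assigned-member x (∈⇒T-lookup x∈X))
    where open MatchingFromShift X a a≤wrapCount |X|≤r fallback fits

  r≤firstsBelow-n : r ≤ firstsBelow n
  r≤firstsBelow-n = begin
    r                               ≡⟨ sym (count-const-true {r}) ⟩
    count {r} (λ _ → true)          ≤⟨ count-mono _ (λ b → start b <ᵇ n) (λ b _ → <⇒<ᵇ (toℕ<n (first I b))) ⟩
    count (λ b → start b <ᵇ n)      ≡⟨ sym (countBelow-isFirst n) ⟩
    firstsBelow n                   ∎
    where open ≤-Reasoning hiding (start)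

  below-insert : ∀ X e → e ∉ X → ∀ j → below (X ∪ ⁅ e ⁆) j ≡ below X j + indicator (toℕ e <ᵇ j)
  below-insert X e e∉X = countBelow-insert (lookup (X ∪ ⁅ e ⁆)) (lookup X) e λ x →
    trans (cong indicator (trans (lookup-∪ X ⁅ e ⁆ x) (cong (lookup X x ∨_) (lookup-⁅⁆ e x))))
          (indicator-∨ (lookup X x) (x ≟ᵇ e) (λ x∈X x≡e → e∉X (subst (_∈ X) (≟ᵇ⇒≡ x≡e) (T-lookup⇒∈ x∈X))))

  below-remove : ∀ X e → e ∈ X → ∀ j → below X j ≡ below (X - e) j + indicator (toℕ e <ᵇ j)
  below-remove X e e∈X = countBelow-insert (lookup X) (lookup (X - e)) e λ x →
    trans (pointwise (lookup X x) (x ≟ᵇ e) (λ x≡e → subst (T ∘ lookup X) (sym (≟ᵇ⇒≡ x≡e)) (∈⇒T-lookup e∈X)))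
          (cong (λ b → indicator b + indicator (x ≟ᵇ e)) (sym (lookup-minus X e x)))
    where
    pointwise : ∀ b c → (T c → T b) → indicator b ≡ indicator (b ∧ not c) + indicator c
    pointwise true true _ = refl
    pointwise true false _ = refl
    pointwise false false _ = refl
    pointwise false true c⇒b = ⊥-elim (c⇒b tt)

  StrictlyBelowQ : Subset n → ℕ → ℕ → Set
  StrictlyBelowQ X a j = a + below X j < wrapCount + firstsBelow j

  -- Adding e raises the path by one after step e, which the strict inequalities there absorb.
  insert-fits : ∀ X a e → e ∉ X → (∀ j → j ≤ n → Fits X a j) →
    (∀ j → toℕ e < j → j ≤ n → StrictlyBelowQ X a j) → ∀ j → j ≤ n → Fits (X ∪ ⁅ e ⁆) a j
  insert-fits X a e e∉X fits strict j j≤n = lower , upper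
    where
    lower : lastsBelow j ≤ a + below (X ∪ ⁅ e ⁆) j
    lower = ≤-trans (proj₁ (fits j j≤n))
      (+-monoʳ-≤ a (subst (below X j ≤_) (sym (below-insert X e e∉X j)) (m≤m+n _ _)))
    upper : a + below (X ∪ ⁅ e ⁆) j ≤ wrapCount + firstsBelow j
    upper with toℕ e <? j
    ... | yes e<j = subst (_≤ wrapCount + firstsBelow j)
                      (sym (trans (cong (a +_) (trans (below-insert X e e∉X j) (cong (below X j +_) (indicator-true (<⇒<ᵇ e<j)))))
                                  (trans (cong (a +_) (+-comm _ 1)) (+-suc a _))))
                      (strict j e<j j≤n)
    ... | no e≮j = subst (_≤ wrapCount + firstsBelow j)
                     (sym (cong (a +_) (trans (below-insert X e e∉X j)
                                              (trans (cong (below X j +_) (indicator-false (e≮j ∘ <ᵇ⇒< _ _))) (+-identityʳ _)))))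
                     (proj₂ (fits j j≤n))

  StrictlyBelowQ-at-n : ∀ X a → a ≤ wrapCount → count (lookup X) < r → StrictlyBelowQ X a n
  StrictlyBelowQ-at-n X a a≤wrapCount |X|<r = begin-strict
    a + below X n             ≡⟨ cong (a +_) (countBelow-beyond (lookup X) ≤-refl) ⟩
    a + count (lookup X)      <⟨ +-monoʳ-< a |X|<r ⟩
    a + r                     ≤⟨ +-mono-≤ a≤wrapCount r≤firstsBelow-n ⟩
    wrapCount + firstsBelow n ∎
    where open ≤-Reasoning hiding (start)

  StrictlyBelowQ-step : ∀ X a x → T (lookup X x) →
    StrictlyBelowQ X a (suc (toℕ x)) → StrictlyBelowQ X a (toℕ x)
  StrictlyBelowQ-step X a x x∈X strict-after = +-cancelʳ-< 1 _ _ (begin-strict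
    a + below X (toℕ x) + 1               ≡⟨ +-assoc a _ 1 ⟩
    a + (below X (toℕ x) + 1)             ≡⟨ cong (a +_) (sym (trans (countBelow-step (lookup X) x)
                                                                     (cong (below X (toℕ x) +_) (indicator-true x∈X)))) ⟩
    a + below X (suc (toℕ x))             <⟨ strict-after ⟩
    wrapCount + firstsBelow (suc (toℕ x)) ≤⟨ +-monoʳ-≤ wrapCount (countBelow-suc-≤ (isFirst I) (toℕ x)) ⟩
    wrapCount + (firstsBelow (toℕ x) + 1) ≡⟨ sym (+-assoc wrapCount _ 1) ⟩
    wrapCount + firstsBelow (toℕ x) + 1   ∎)
    where open ≤-Reasoning hiding (start)

  count-insert : ∀ X e → e ∉ X → count (lookup (X ∪ ⁅ e ⁆)) ≡ suc (count (lookup X))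
  count-insert X e e∉X = begin
    count (lookup (X ∪ ⁅ e ⁆))            ≡⟨ sym (countBelow-beyond (lookup (X ∪ ⁅ e ⁆)) ≤-refl) ⟩
    below (X ∪ ⁅ e ⁆) n                   ≡⟨ below-insert X e e∉X n ⟩
    below X n + indicator (toℕ e <ᵇ n)    ≡⟨ cong₂ _+_ (countBelow-beyond (lookup X) ≤-refl) (indicator-true (<⇒<ᵇ (toℕ<n e))) ⟩
    count (lookup X) + 1                  ≡⟨ +-comm _ 1 ⟩
    suc (count (lookup X))                ∎
    where open ≡-Reasoning

  basis∧fits⇒no-slack-after-nonmember : ∀ B a → Basis I B → a ≤ wrapCount → count (lookup B) < r →
    (∀ j → j ≤ n → Fits B a j) → ∀ e → e ∉ B → ¬ (∀ j → toℕ e < j → j ≤ n → StrictlyBelowQ B a j)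
  basis∧fits⇒no-slack-after-nonmember B a ((φ , _) , maximal) a≤wrapCount |B|<r fits e e∉B strict =
    e∉B (maximal (B ∪ ⁅ e ⁆) (λ {x} → p⊆p∪q ⁅ e ⁆ {x = x}) independent (q⊆p∪q B ⁅ e ⁆ (x∈⁅x⁆ e)))
    where
    independent : Independent I (B ∪ ⁅ e ⁆)
    independent = fits⇒independent (B ∪ ⁅ e ⁆) a a≤wrapCount
      (subst (_≤ r) (sym (count-insert B e e∉B)) |B|<r) (φ e) (insert-fits B a e e∉B fits strict)

  -- A basis whose path fits has r elements: otherwise one could add the last element after which
  -- the path stays strictly below Q.
  basis∧fits⇒count≡r : ∀ B a → Basis I B → r ≤ n → a ≤ wrapCount → (∀ j → j ≤ n → Fits B a j) →
    count (lookup B) ≡ r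
  basis∧fits⇒count≡r B a basis r≤n a≤wrapCount fits =
    ≤-antisym (independent⇒count≤r B (proj₁ basis)) (≮⇒≥ λ |B|<r →
      let no-slack = basis∧fits⇒no-slack-after-nonmember B a basis a≤wrapCount |B|<r fits
          (e , e∉B) = count<n⇒nonmember (lookup B) (<-≤-trans |B|<r r≤n)
      in [ (λ (e′ , e′∉B , strict) → no-slack e′ (e′∉B ∘ ∈⇒T-lookup) strict)
         , (λ strict → no-slack e (e∉B ∘ ∈⇒T-lookup) (λ j _ → strict j))
         ]′ (downwards-from-last-nonmember (lookup B) (StrictlyBelowQ B a)
               (StrictlyBelowQ-at-n B a a≤wrapCount |B|<r) (StrictlyBelowQ-step B a)))

  pt-diagonal : ∀ i → 1 ≤ i → i ≤ kOf I → proj₁ (pt I i) + proj₂ (pt I i) ≡ wrapCount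
  pt-diagonal (suc i) _ 1+i≤k = trans (cong (λ k → k ∸ suc i + i) kOf≡1+wrapCount)
    (m∸n+n≡m (s≤s⁻¹ (subst (suc i ≤_) kOf≡1+wrapCount 1+i≤k)))

  kOf-positive : 1 ≤ kOf I
  kOf-positive = subst (1 ≤_) (sym kOf≡1+wrapCount) (s≤s z≤n)

  kOf∸1≡wrapCount : kOf I ∸ 1 ≡ wrapCount
  kOf∸1≡wrapCount = cong (_∸ 1) kOf≡1+wrapCount

  valid⇒fits : ∀ X i → 1 ≤ i → i ≤ kOf I → Valid I X (pt I i) → ∀ j → j ≤ n → Fits X (i ∸ 1) j
  valid⇒fits X i 1≤i i≤k valid j j≤n with valid j j≤n
  ... | (d , d≤n , onDiagonal , Q≤Π , Π≤P) =
    subst (λ e → lastsBelow e ≤ (i ∸ 1) + below X j) d≡j (diagonal-antitone (sym Π~P) Π≤P) ,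
    subst₂ (λ w e → (i ∸ 1) + below X j ≤ w + firstsBelow e) kOf∸1≡wrapCount d≡j (diagonal-antitone (sym Q~Π) Q≤Π)
    where
    Π~ : proj₁ (Π X (pt I i) j) + proj₂ (Π X (pt I i) j) ≡ wrapCount + j
    Π~ = trans (stepPath-diagonal (lookup X) (pt I i) j j≤n) (cong (_+ j) (pt-diagonal i 1≤i i≤k))
    d≡j : d ≡ j
    d≡j = +-cancelˡ-≡ wrapCount _ _ (trans (sym (trans onDiagonal (cong (_+ d) kOf∸1≡wrapCount))) Π~)
    Q~Π : proj₁ (Qb I d) + proj₂ (Qb I d) ≡ proj₁ (Π X (pt I i) j) + proj₂ (Π X (pt I i) j)
    Q~Π = trans (stepPath-diagonal (isFirst I) (pt I (kOf I)) d d≤n)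
            (trans (cong₂ _+_ (pt-diagonal (kOf I) kOf-positive ≤-refl) d≡j) (sym Π~))
    Π~P : proj₁ (Π X (pt I i) j) + proj₂ (Π X (pt I i) j) ≡ proj₁ (Pb I d) + proj₂ (Pb I d)
    Π~P = trans Π~ (sym (trans (stepPath-diagonal (isLast I) (pt I 1) d d≤n)
                                (cong₂ _+_ (pt-diagonal 1 ≤-refl kOf-positive) d≡j)))

  module Exchange (B : Subset n) (u v : Fin n) (i : ℕ) (basis : Basis I B) (u∈B : u ∈ B) (v∉B : v ∉ B)
    (1≤i : 1 ≤ i) (i≤k : i ≤ kOf I) (valid : Valid I B (pt I i)) (r≤n : r ≤ n) where

    a : ℕ
    a = i ∸ 1

    a≤wrapCount : a ≤ wrapCount
    a≤wrapCount = subst (a ≤_) kOf∸1≡wrapCount (∸-monoˡ-≤ 1 i≤k)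

    fitsB : ∀ j → j ≤ n → Fits B a j
    fitsB = valid⇒fits B i 1≤i i≤k valid

    B′ : Subset n
    B′ = (B - u) ∪ ⁅ v ⁆

    c c′ : ℕ → ℕ
    c = below B
    c′ = below B′

    v∉B-u : v ∉ B - u
    v∉B-u v∈B-u = v∉B (T-lookup⇒∈ (proj₁ (to (T-∧ {lookup B v}) (subst T (lookup-minus B u v) (∈⇒T-lookup v∈B-u)))))

    heights-differ : ∀ j → c′ j + indicator (toℕ u <ᵇ j) ≡ c j + indicator (toℕ v <ᵇ j)
    heights-differ j = begin
      c′ j + indicator (toℕ u <ᵇ j)
        ≡⟨ cong (_+ indicator (toℕ u <ᵇ j)) (below-insert (B - u) v v∉B-u j) ⟩
      below (B - u) j + indicator (toℕ v <ᵇ j) + indicator (toℕ u <ᵇ j)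
        ≡⟨ +-assoc (below (B - u) j) _ _ ⟩
      below (B - u) j + (indicator (toℕ v <ᵇ j) + indicator (toℕ u <ᵇ j))
        ≡⟨ cong (below (B - u) j +_) (+-comm (indicator (toℕ v <ᵇ j)) _) ⟩
      below (B - u) j + (indicator (toℕ u <ᵇ j) + indicator (toℕ v <ᵇ j))
        ≡⟨ sym (+-assoc (below (B - u) j) _ _) ⟩
      below (B - u) j + indicator (toℕ u <ᵇ j) + indicator (toℕ v <ᵇ j)
        ≡⟨ cong (_+ indicator (toℕ v <ᵇ j)) (sym (below-remove B u u∈B j)) ⟩
      c j + indicator (toℕ v <ᵇ j) ∎
      where open ≡-Reasoning

    |B′|≡r : count (lookup B′) ≡ r
    |B′|≡r = begin
      count (lookup B′)      ≡⟨ sym (countBelow-beyond (lookup B′) ≤-refl) ⟩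
      c′ n                   ≡⟨ +-cancelʳ-≡ 1 _ _ (subst₂ (λ p q → c′ n + p ≡ c n + q)
                                  (indicator-true (<⇒<ᵇ (toℕ<n u))) (indicator-true (<⇒<ᵇ (toℕ<n v))) (heights-differ n)) ⟩
      c n                    ≡⟨ countBelow-beyond (lookup B) ≤-refl ⟩
      count (lookup B)       ≡⟨ basis∧fits⇒count≡r B a basis r≤n a≤wrapCount fitsB ⟩
      r                      ∎
      where open ≡-Reasoning

    basis′⇒fits : Basis I B′ → Σ ℕ λ a′ → a′ ≤ wrapCount × (∀ j → Fits B′ a′ j)
    basis′⇒fits basis′ = independent⇒fits B′ (proj₁ basis′) |B′|≡r

    fits⇒basis′ : ∀ a′ → a′ ≤ wrapCount → (∀ j → j ≤ n → Fits B′ a′ j) → Basis I B′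
    fits⇒basis′ a′ a′≤wrapCount fits = independent∧count≡r⇒basis B′
      (fits⇒independent B′ a′ a′≤wrapCount (≤-reflexive |B′|≡r) (proj₁ (proj₁ basis) u) fits) |B′|≡r

    OnP OnQ : ℕ → Set
    OnP j = a + c j ≡ lastsBelow j
    OnQ j = a + c j ≡ wrapCount + firstsBelow j

    TouchesP TouchesQ : ℕ → ℕ → Set
    TouchesP lo hi = TouchesOn B (pt I i) lo hi (Pb I)
    TouchesQ lo hi = TouchesOn B (pt I i) lo hi (Qb I)

    diagonal-P : proj₁ (pt I i) + proj₂ (pt I i) ≡ proj₁ (pt I 1) + proj₂ (pt I 1)
    diagonal-P = trans (pt-diagonal i 1≤i i≤k) (sym (pt-diagonal 1 ≤-refl kOf-positive))

    diagonal-Q : proj₁ (pt I i) + proj₂ (pt I i) ≡ proj₁ (pt I (kOf I)) + proj₂ (pt I (kOf I))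
    diagonal-Q = trans (pt-diagonal i 1≤i i≤k) (sym (pt-diagonal (kOf I) kOf-positive ≤-refl))

    touchesP⇒OnP : ∀ {lo hi} → hi ≤ n → TouchesP lo hi → Σ ℕ λ j → lo ≤ j × j ≤ hi × OnP j
    touchesP⇒OnP = touchesOn⇒sameHeight (isLast I) (pt I 1) B (pt I i) diagonal-P

    OnP⇒touchesP : ∀ {lo hi} j → lo ≤ j → j ≤ hi → j ≤ n → OnP j → TouchesP lo hi
    OnP⇒touchesP j = sameHeight⇒touchesOn (isLast I) (pt I 1) B (pt I i) j diagonal-P

    touchesQ⇒OnQ : ∀ {lo hi} → hi ≤ n → TouchesQ lo hi → Σ ℕ λ j → lo ≤ j × j ≤ hi × OnQ j
    touchesQ⇒OnQ hi≤n t with touchesOn⇒sameHeight (isFirst I) (pt I (kOf I)) B (pt I i) diagonal-Q hi≤n t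
    ... | (j , lo≤j , j≤hi , same) = j , lo≤j , j≤hi , trans same (cong (_+ firstsBelow j) kOf∸1≡wrapCount)

    OnQ⇒touchesQ : ∀ {lo hi} j → lo ≤ j → j ≤ hi → j ≤ n → OnQ j → TouchesQ lo hi
    OnQ⇒touchesQ j lo≤j j≤hi j≤n onQ = sameHeight⇒touchesOn (isFirst I) (pt I (kOf I)) B (pt I i) j diagonal-Q
      lo≤j j≤hi j≤n (trans onQ (cong (_+ firstsBelow j) (sym kOf∸1≡wrapCount)))

    OnP-start : a ≡ 0 → OnP 0
    OnP-start a≡0 = trans (cong₂ _+_ a≡0 (countBelow-zero (lookup B))) (sym (countBelow-zero (isLast I)))

    OnQ-start : a ≡ wrapCount → OnQ 0
    OnQ-start a≡K = trans (cong₂ _+_ a≡K (countBelow-zero (lookup B)))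
                          (cong (wrapCount +_) (sym (countBelow-zero (isFirst I))))

    u≤n : toℕ u ≤ n
    u≤n = <⇒≤ (toℕ<n u)

    v≤n : toℕ v ≤ n
    v≤n = <⇒≤ (toℕ<n v)

    module Earlier (v<u : toℕ v < toℕ u) where
      V U : ℕ
      V = toℕ v
      U = toℕ u

      module D (j : ℕ) = TwoStepDifference {c = c j} {c′ j} {j} v<u (heights-differ j)

      fits-from-above⇒¬touchQ : ∀ a′ → (∀ j → Fits B′ a′ j) → a ≤ a′ → ¬ TouchesQ (suc V) U
      fits-from-above⇒¬touchQ a′ fits′ a≤a′ touch with touchesQ⇒OnQ u≤n touch
      ... | (j , V<j , j≤U , onQ) = <-irrefl refl (begin-strict
        a + c j                    <⟨ +-monoʳ-< a (n<1+n (c j)) ⟩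
        a + suc (c j)              ≤⟨ +-mono-≤ a≤a′ (≤-reflexive (sym (D.≡suc-between j V<j j≤U))) ⟩
        a′ + c′ j                  ≤⟨ proj₂ (fits′ j) ⟩
        wrapCount + firstsBelow j  ≡⟨ sym onQ ⟩
        a + c j                    ∎)
        where open ≤-Reasoning hiding (start)

      fits-from-below⇒¬touchP : ∀ a′ → (∀ j → Fits B′ a′ j) → a′ < a → ¬ TouchesP 0 V × ¬ TouchesP (suc U) n
      fits-from-below⇒¬touchP a′ fits′ a′<a = before , after
        where
        off-P : ∀ j → c′ j ≡ c j → ¬ OnP j
        off-P j same onP = <-irrefl refl (begin-strict
          lastsBelow j  ≤⟨ proj₁ (fits′ j) ⟩
          a′ + c′ j     ≡⟨ cong (a′ +_) same ⟩
          a′ + c j      <⟨ +-monoˡ-< (c j) a′<a ⟩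
          a + c j       ≡⟨ onP ⟩
          lastsBelow j  ∎)
          where open ≤-Reasoning hiding (start)
        before : ¬ TouchesP 0 V
        before touch = let (j , _ , j≤V , onP) = touchesP⇒OnP v≤n touch in off-P j (D.≡-before j j≤V) onP
        after : ¬ TouchesP (suc U) n
        after touch = let (j , U<j , _ , onP) = touchesP⇒OnP ≤-refl touch in off-P j (D.≡-after j U<j) onP

      basis⇒ : Basis I B′ → ¬ TouchesQ (suc V) U ⊎ (¬ TouchesP 0 V × ¬ TouchesP (suc U) n)
      basis⇒ basis′ = let (a′ , _ , fits′) = basis′⇒fits basis′ in
        [ inj₁ ∘ fits-from-above⇒¬touchQ a′ fits′ , inj₂ ∘ fits-from-below⇒¬touchP a′ fits′ ]′ (≤-<-connex a a′)

      -- Either the path keeps its start p_i, or it starts one lattice point lower, at p_{i-1}.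
      basis⇐ : ¬ TouchesQ (suc V) U ⊎ (¬ TouchesP 0 V × ¬ TouchesP (suc U) n) → Basis I B′
      basis⇐ (inj₁ ¬touchQ) = fits⇒basis′ a a≤wrapCount λ j j≤n →
        ≤-trans (proj₁ (fitsB j j≤n)) (+-monoʳ-≤ a (proj₁ (D.bounds j))) , upper j j≤n
        where
        upper : ∀ j → j ≤ n → a + c′ j ≤ wrapCount + firstsBelow j
        upper j j≤n with regions V U j
        ... | inj₁ j≤V = subst (λ h → a + h ≤ wrapCount + firstsBelow j) (sym (D.≡-before j j≤V)) (proj₂ (fitsB j j≤n))
        ... | inj₂ (inj₂ U<j) = subst (λ h → a + h ≤ wrapCount + firstsBelow j) (sym (D.≡-after j U<j)) (proj₂ (fitsB j j≤n))
        ... | inj₂ (inj₁ (V<j , j≤U)) = subst (λ h → a + h ≤ wrapCount + firstsBelow j) (sym (D.≡suc-between j V<j j≤U))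
          (subst (_≤ wrapCount + firstsBelow j) (sym (+-suc a (c j)))
            (≤∧≢⇒< (proj₂ (fitsB j j≤n)) (¬touchQ ∘ OnQ⇒touchesQ j V<j j≤U j≤n)))
      basis⇐ (inj₂ (¬touchP-before , ¬touchP-after)) =
        fits⇒basis′ (a ∸ 1) (≤-trans (m∸n≤m a 1) a≤wrapCount) λ j j≤n → lower j j≤n , upper j j≤n
        where
        a≢0 : a ≢ 0
        a≢0 a≡0 = ¬touchP-before (OnP⇒touchesP 0 z≤n z≤n z≤n (OnP-start a≡0))
        lowered : ∀ h → a ∸ 1 + suc h ≡ a + h
        lowered h = trans (+-suc (a ∸ 1) h) (cong (_+ h) (trans (+-comm 1 (a ∸ 1)) (m∸n+n≡m (n≢0⇒n>0 a≢0))))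
        upper : ∀ j → j ≤ n → a ∸ 1 + c′ j ≤ wrapCount + firstsBelow j
        upper j j≤n = ≤-trans (+-monoʳ-≤ (a ∸ 1) (proj₂ (D.bounds j)))
                              (subst (_≤ wrapCount + firstsBelow j) (sym (lowered (c j))) (proj₂ (fitsB j j≤n)))
        unchanged : ∀ j → j ≤ n → ¬ OnP j → c′ j ≡ c j → lastsBelow j ≤ a ∸ 1 + c′ j
        unchanged j j≤n ¬onP same = subst (λ h → lastsBelow j ≤ a ∸ 1 + h) (sym same)
          (s≤s⁻¹ (subst (lastsBelow j <_) (trans (sym (lowered (c j))) (+-suc (a ∸ 1) (c j)))
                   (≤∧≢⇒< (proj₁ (fitsB j j≤n)) (¬onP ∘ sym))))
        lower : ∀ j → j ≤ n → lastsBelow j ≤ a ∸ 1 + c′ j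
        lower j j≤n with regions V U j
        ... | inj₁ j≤V = unchanged j j≤n (¬touchP-before ∘ OnP⇒touchesP j z≤n j≤V j≤n) (D.≡-before j j≤V)
        ... | inj₂ (inj₂ U<j) = unchanged j j≤n (¬touchP-after ∘ OnP⇒touchesP j U<j j≤n j≤n) (D.≡-after j U<j)
        ... | inj₂ (inj₁ (V<j , j≤U)) = subst (λ h → lastsBelow j ≤ a ∸ 1 + h) (sym (D.≡suc-between j V<j j≤U))
          (subst (lastsBelow j ≤_) (sym (lowered (c j))) (proj₁ (fitsB j j≤n)))

    module Later (u<v : toℕ u < toℕ v) where
      U V : ℕ
      U = toℕ u
      V = toℕ v

      module D (j : ℕ) = TwoStepDifference {c = c′ j} {c j} {j} u<v (sym (heights-differ j))

      fits-from-below⇒¬touchP : ∀ a′ → (∀ j → Fits B′ a′ j) → a′ ≤ a → ¬ TouchesP (suc U) V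
      fits-from-below⇒¬touchP a′ fits′ a′≤a touch =
        let (j , U<j , j≤V , onP) = touchesP⇒OnP v≤n touch in
        <-irrefl refl (begin-strict
          lastsBelow j     ≤⟨ proj₁ (fits′ j) ⟩
          a′ + c′ j        ≤⟨ +-monoˡ-≤ (c′ j) a′≤a ⟩
          a + c′ j         <⟨ +-monoʳ-< a (n<1+n (c′ j)) ⟩
          a + suc (c′ j)   ≡⟨ cong (a +_) (sym (D.≡suc-between j U<j j≤V)) ⟩
          a + c j          ≡⟨ onP ⟩
          lastsBelow j     ∎)
        where open ≤-Reasoning hiding (start)

      fits-from-above⇒¬touchQ : ∀ a′ → (∀ j → Fits B′ a′ j) → a < a′ → ¬ TouchesQ 0 U × ¬ TouchesQ (suc V) n
      fits-from-above⇒¬touchQ a′ fits′ a<a′ = before , after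
        where
        off-Q : ∀ j → c j ≡ c′ j → ¬ OnQ j
        off-Q j same onQ = <-irrefl refl (begin-strict
          a + c j                    <⟨ +-monoˡ-< (c j) a<a′ ⟩
          a′ + c j                   ≡⟨ cong (a′ +_) same ⟩
          a′ + c′ j                  ≤⟨ proj₂ (fits′ j) ⟩
          wrapCount + firstsBelow j  ≡⟨ sym onQ ⟩
          a + c j                    ∎)
          where open ≤-Reasoning hiding (start)
        before : ¬ TouchesQ 0 U
        before touch = let (j , _ , j≤U , onQ) = touchesQ⇒OnQ u≤n touch in off-Q j (D.≡-before j j≤U) onQ
        after : ¬ TouchesQ (suc V) n
        after touch = let (j , V<j , _ , onQ) = touchesQ⇒OnQ ≤-refl touch in off-Q j (D.≡-after j V<j) onQ

      basis⇒ : Basis I B′ → ¬ TouchesP (suc U) V ⊎ (¬ TouchesQ 0 U × ¬ TouchesQ (suc V) n)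
      basis⇒ basis′ = let (a′ , _ , fits′) = basis′⇒fits basis′ in
        [ inj₁ ∘ fits-from-below⇒¬touchP a′ fits′ , inj₂ ∘ fits-from-above⇒¬touchQ a′ fits′ ]′ (≤-<-connex a′ a)

      -- Either the path keeps its start p_i, or it starts one lattice point higher, at p_{i+1}.
      basis⇐ : ¬ TouchesP (suc U) V ⊎ (¬ TouchesQ 0 U × ¬ TouchesQ (suc V) n) → Basis I B′
      basis⇐ (inj₁ ¬touchP) = fits⇒basis′ a a≤wrapCount λ j j≤n →
        lower j j≤n , ≤-trans (+-monoʳ-≤ a (proj₁ (D.bounds j))) (proj₂ (fitsB j j≤n))
        where
        lower : ∀ j → j ≤ n → lastsBelow j ≤ a + c′ j
        lower j j≤n with regions U V j
        ... | inj₁ j≤U = subst (λ h → lastsBelow j ≤ a + h) (D.≡-before j j≤U) (proj₁ (fitsB j j≤n))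
        ... | inj₂ (inj₂ V<j) = subst (λ h → lastsBelow j ≤ a + h) (D.≡-after j V<j) (proj₁ (fitsB j j≤n))
        ... | inj₂ (inj₁ (U<j , j≤V)) = s≤s⁻¹ (subst (lastsBelow j <_)
          (trans (cong (a +_) (D.≡suc-between j U<j j≤V)) (+-suc a (c′ j)))
          (≤∧≢⇒< (proj₁ (fitsB j j≤n)) (¬touchP ∘ OnP⇒touchesP j U<j j≤V j≤n ∘ sym)))
      basis⇐ (inj₂ (¬touchQ-before , ¬touchQ-after)) = fits⇒basis′ (suc a) a<wrapCount λ j j≤n →
        lower j j≤n , upper j j≤n
        where
        a<wrapCount : a < wrapCount
        a<wrapCount = ≤∧≢⇒< a≤wrapCount (¬touchQ-before ∘ OnQ⇒touchesQ 0 z≤n z≤n z≤n ∘ OnQ-start)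
        lower : ∀ j → j ≤ n → lastsBelow j ≤ suc a + c′ j
        lower j j≤n = ≤-trans (proj₁ (fitsB j j≤n))
                              (subst (a + c j ≤_) (+-suc a (c′ j)) (+-monoʳ-≤ a (proj₂ (D.bounds j))))
        unchanged : ∀ j → j ≤ n → ¬ OnQ j → c j ≡ c′ j → suc a + c′ j ≤ wrapCount + firstsBelow j
        unchanged j j≤n ¬onQ same = subst (λ h → suc a + h ≤ wrapCount + firstsBelow j) same
          (≤∧≢⇒< (proj₂ (fitsB j j≤n)) ¬onQ)
        upper : ∀ j → j ≤ n → suc a + c′ j ≤ wrapCount + firstsBelow j
        upper j j≤n with regions U V j
        ... | inj₁ j≤U = unchanged j j≤n (¬touchQ-before ∘ OnQ⇒touchesQ j z≤n j≤U j≤n) (D.≡-before j j≤U)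
        ... | inj₂ (inj₂ V<j) = unchanged j j≤n (¬touchQ-after ∘ OnQ⇒touchesQ j V<j j≤n j≤n) (D.≡-after j V<j)
        ... | inj₂ (inj₁ (U<j , j≤V)) = subst (_≤ wrapCount + firstsBelow j)
          (trans (cong (a +_) (D.≡suc-between j U<j j≤V)) (+-suc a (c′ j))) (proj₂ (fitsB j j≤n))

lemma5p2 : (m r : ℕ) (I : Intervals (m + r) r) → Antichain I → HasRank I r →
  (B : Subset (m + r)) (u v : Fin (m + r)) (i : ℕ) →
  Basis I B → u ∈ B → v ∉ B → 1 ≤ i → i ≤ kOf I → Valid I B (pt I i) →
  ((toℕ v < toℕ u) →
    (Basis I ((B - u) ∪ ⁅ v ⁆) ⇔
      (¬ TouchesOn B (pt I i) (suc (toℕ v)) (toℕ u) (Qb I)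
       ⊎ (¬ TouchesOn B (pt I i) 0 (toℕ v) (Pb I)
          × ¬ TouchesOn B (pt I i) (suc (toℕ u)) (m + r) (Pb I)))))
  × ((toℕ u < toℕ v) →
    (Basis I ((B - u) ∪ ⁅ v ⁆) ⇔
      (¬ TouchesOn B (pt I i) (suc (toℕ u)) (toℕ v) (Pb I)
       ⊎ (¬ TouchesOn B (pt I i) 0 (toℕ u) (Qb I)
          × ¬ TouchesOn B (pt I i) (suc (toℕ v)) (m + r) (Qb I)))))
lemma5p2 m r I antichain _ B u v i basis u∈B v∉B 1≤i i≤k valid =
  (λ v<u → mk⇔ (Earlier.basis⇒ v<u) (Earlier.basis⇐ v<u)) ,
  (λ u<v → mk⇔ (Later.basis⇒ u<v) (Later.basis⇐ u<v))
  where
  open LatticePaths.Exchange I antichain B u v i basis u∈B v∉B 1≤i i≤k valid (m≤n+m r m)
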